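{- Let $G$ be a connected block graph which is not complete, with vertex weights $w: V(G)\to\mathbb{Z}^+$. Let $T$ be the block-cutpoint-tree of $G$, rooted at a cutpoint $r$ of $G$. Define functions $f_1,f_2,f_3$ on the nodes of $T$ bottom-up as follows (below $v$ denotes a node of $T$ that is a cutpoint of $G$ and $b$ a node that is a block of $G$; all leaves of $T$ are blocks): if $C(b)=\emptyset$, then $f_1(b)=s(b)$, $f_2(b)=0$, $f_3(b)=0$; otherwise $f_1(v) = w(v) + \sum_{b\in C(v)} f_2(b)$; $f_1(b) = s(b) + \sum_{v\in C(b)} f_1(v)$; if $|C(v)|\leq 2$ then $f_2(v) = \sum_{b\in C(v)} f_3(b)$, and if $|C(v)|\geq 3$ then $f_2(v) = \min_{b_1,b_2\in C(v)} \big(\sum_{b\in\{b_1,b_2\}} f_3(b) + \sum_{b\in C(v)\setminus\{b_1,b_2\}} f_1(b)\big)$; $f_2(b) = \min\Big\{ \sum_{v\in C(b)} \min\{f_1(v),f_3(v)\},\ \min_{v_1\in C(b)}\big(s(b) + f_2(v_1) + \sum_{v\in C(b)\setminus\{v_1\}} f_1(v)\big)\Big\}$; $f_3(b) = \sum_{v\in C(b)} \min\{f_1(v),f_3(v)\}$; if $C(v)=\{b\}$ then $f_3(v) = f_3(b)$, and if $|C(v)|\geq 2$ then $f_3(v) = \min_{b_1\in C(v)}\big(f_3(b_1) + \sum_{b\in C(v)\setminus\{b_1\}} f_1(b)\big)$. Then $f(r) = \min\{f_1(r), f_2(r)\}$ equals the minimum weight of a claw-deletion set of $G$.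
   Context: Graphs are finite, simple, undirected. A claw is $K_{1,3}$; a set $S\subseteq V(G)$ is a claw-deletion set of $G$ if the subgraph induced by $V(G)\setminus S$ has no induced $K_{1,3}$; its weight is $\sum_{u\in S} w(u)$. A cutpoint is a vertex whose removal increases the number of connected components; a block is a maximal 2-connected subgraph; a block graph is a graph in which every block is a clique. The block-cutpoint-tree of a connected graph $G$ is the bipartite graph whose vertices are the cutpoints and the blocks of $G$, a cutpoint being adjacent to a block when it belongs to it; it is a tree. For a node $x$ of the rooted tree $T$: $T_x$ is the subtree rooted at $x$, $C(x)$ its set of children, $p_T(x)$ its parent, and $T_x^+$ the subtree $T_x$ together with $p_T(x)$. For a node $x$, $G_x$ is the subgraph of $G$ induced by (the union of the vertex sets of) the blocks that are nodes of $T_x$; for a cutpoint $v\neq r$, $G_v^+$ is the subgraph of $G$ induced by the blocks that are nodes of $T_v^+$. For a block $b$, $G_b^- = G_b\setminus\{p_T(b)\}$, and $s(b)$ is the sum of the weights of the vertices of $b$ that are not cutpoints of $G$ ($s(b)=0$ if there are none). -}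

module Defs where

open import Data.Nat using (ℕ; zero; suc; _+_; _≤_; _⊓_)
open import Data.Bool using (Bool; true; false; if_then_else_)
open import Data.Fin using (Fin)
open import Data.Fin.Subset using (Subset; _∈_; _∉_; _⊆_; ∣_∣)
open import Data.Vec using (lookup)
open import Data.List using (List; []; _∷_; _++_; map; foldr)
open import Data.Nat.ListAction using (sum)
open import Data.List.Base using (allFin)
open import Data.List.Membership.Propositional using () renaming (_∈_ to _∈L_)
open import Data.List.Relation.Unary.Unique.Propositional using (Unique)
open import Data.Product using (Σ; ∃; _×_; _,_; proj₁; proj₂)
open import Data.Unit using (⊤)
open import Data.Empty using (⊥)
open import Relation.Nullary using (¬_)
open import Relation.Binary.PropositionalEquality using (_≡_; _≢_)
open import Function.Bundles using (_⇔_)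

record Graph (n : ℕ) : Set where
  field
    adj    : Fin n → Fin n → Bool
    sym    : ∀ u v → adj u v ≡ adj v u
    irrefl : ∀ u → adj u u ≡ false

module _ {n : ℕ} (G : Graph n) where

  Adj : Fin n → Fin n → Set
  Adj u v = Graph.adj G u v ≡ true

  data Reach (P : Fin n → Set) : Fin n → Fin n → Set where
    here : ∀ {x} → P x → Reach P x x
    step : ∀ {x y z} → Reach P x y → Adj y z → P z → Reach P x z

  ConnectedOn : (Fin n → Set) → Set
  ConnectedOn P = ∀ x y → P x → P y → Reach P x y

  Connected : Set
  Connected = ConnectedOn (λ _ → ⊤)

  -- v is a cutpoint: removing v increases the number of connected
  -- components, i.e. some two vertices other than v lie in the same
  -- component of G but in different components of G - v.
  Cutpoint : Fin n → Set
  Cutpoint v = Σ (Fin n) λ x → Σ (Fin n) λ y →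
    x ≢ v × y ≢ v × Reach (λ _ → ⊤) x y × ¬ Reach (λ u → u ≢ v) x y

  Biconnected : Subset n → Set
  Biconnected B = 2 ≤ ∣ B ∣ × ConnectedOn (_∈ B)
                × (∀ x → x ∈ B → ConnectedOn (λ u → u ∈ B × u ≢ x))

  IsBlock : Subset n → Set
  IsBlock B = Biconnected B × (∀ B′ → B ⊆ B′ → Biconnected B′ → B′ ⊆ B)

  IsClique : Subset n → Set
  IsClique B = ∀ x y → x ∈ B → y ∈ B → x ≢ y → Adj x y

  BlockGraph : Set
  BlockGraph = ∀ B → IsBlock B → IsClique B

  Complete : Set
  Complete = ∀ x y → x ≢ y → Adj x y

  ClawDeletionSet : Subset n → Set
  ClawDeletionSet S = ¬ (Σ (Fin n) λ a → Σ (Fin n) λ x → Σ (Fin n) λ y → Σ (Fin n) λ z →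
      a ∉ S × x ∉ S × y ∉ S × z ∉ S
    × x ≢ y × x ≢ z × y ≢ z
    × Adj a x × Adj a y × Adj a z
    × ¬ Adj x y × ¬ Adj x z × ¬ Adj y z)

module _ {n : ℕ} (w : Fin n → ℕ) where

  weight : Subset n → ℕ
  weight S = sum (map (λ u → if lookup S u then w u else 0) (allFin n))

  data WSum (P : Fin n → Set) : List (Fin n) → ℕ → Set where
    nil  : WSum P [] 0
    keep : ∀ {x xs k} → P x → WSum P xs k → WSum P (x ∷ xs) (w x + k)
    skip : ∀ {x xs k} → ¬ P x → WSum P xs k → WSum P (x ∷ xs) k

IsSFun : ∀ {n} → Graph n → (Fin n → ℕ) → (Subset n → ℕ) → Set
IsSFun {n} G w s = ∀ B → IsBlock G B →
  WSum w (λ u → u ∈ B × ¬ Cutpoint G u) (allFin n) (s B)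

mutual
  data CNode (n : ℕ) : Set where
    cnode : Fin n → List (BNode n) → CNode n

  data BNode (n : ℕ) : Set where
    bnode : Subset n → List (CNode n) → BNode n

label : ∀ {n} → CNode n → Fin n
label (cnode v _) = v

bset : ∀ {n} → BNode n → Subset n
bset (bnode B _) = B

module _ {n : ℕ} where
  mutual
    cutsC : CNode n → List (Fin n)
    cutsC (cnode v bs) = v ∷ cutsBs bs
    cutsBs : List (BNode n) → List (Fin n)
    cutsBs [] = []
    cutsBs (b ∷ bs) = cutsB b ++ cutsBs bs
    cutsB : BNode n → List (Fin n)
    cutsB (bnode B cs) = cutsCs cs
    cutsCs : List (CNode n) → List (Fin n)
    cutsCs [] = []
    cutsCs (c ∷ cs) = cutsC c ++ cutsCs cs

  mutual
    blocksC : CNode n → List (Subset n)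
    blocksC (cnode v bs) = blocksBs bs
    blocksBs : List (BNode n) → List (Subset n)
    blocksBs [] = []
    blocksBs (b ∷ bs) = blocksB b ++ blocksBs bs
    blocksB : BNode n → List (Subset n)
    blocksB (bnode B cs) = B ∷ blocksCs cs
    blocksCs : List (CNode n) → List (Subset n)
    blocksCs [] = []
    blocksCs (c ∷ cs) = blocksC c ++ blocksCs cs

  mutual
    edgesC : CNode n → List (Fin n × Subset n)
    edgesC (cnode v bs) = map (λ b → (v , bset b)) bs ++ edgesBs bs
    edgesBs : List (BNode n) → List (Fin n × Subset n)
    edgesBs [] = []
    edgesBs (b ∷ bs) = edgesB b ++ edgesBs bs
    edgesB : BNode n → List (Fin n × Subset n)
    edgesB (bnode B cs) = map (λ c → (label c , B)) cs ++ edgesCs cs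
    edgesCs : List (CNode n) → List (Fin n × Subset n)
    edgesCs [] = []
    edgesCs (c ∷ cs) = edgesC c ++ edgesCs cs

IsBlockCutpointTree : ∀ {n} → Graph n → Fin n → CNode n → Set
IsBlockCutpointTree {n} G r T =
    label T ≡ r
  × Unique (cutsC T) × (∀ v → (v ∈L cutsC T) ⇔ Cutpoint G v)
  × Unique (blocksC T) × (∀ B → (B ∈L blocksC T) ⇔ IsBlock G B)
  × (∀ v B → ((v , B) ∈L edgesC T) ⇔ (Cutpoint G v × IsBlock G B × v ∈ B))

record Triple : Set where
  constructor ⟨_,_,_⟩
  field
    f₁ f₂ f₃ : ℕ
open Triple public

-- minimum of a list (only used on non-empty lists)
minList : List ℕ → ℕ
minList [] = 0
minList (x ∷ xs) = foldr _⊓_ x xs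

-- for children with values (aᵢ , cᵢ):  the list over i of  cᵢ + Σ_{k≠i} a_k
pick1 : List (ℕ × ℕ) → List ℕ
pick1 [] = []
pick1 ((a , c) ∷ xs) = (c + sum (map proj₁ xs)) ∷ map (a +_) (pick1 xs)

-- the list over i < j of  cᵢ + c_j + Σ_{k∉{i,j}} a_k
pick2 : List (ℕ × ℕ) → List ℕ
pick2 [] = []
pick2 ((a , c) ∷ xs) = map (c +_) (pick1 xs) ++ map (a +_) (pick2 xs)

combineC : ℕ → List Triple → Triple
combineC wv ts = ⟨ wv + sum (map f₂ ts) , F₂ ts , F₃ ts ⟩
  where
    F₂ : List Triple → ℕ
    F₂ [] = 0
    F₂ (t ∷ []) = f₃ t
    F₂ (t ∷ t′ ∷ []) = f₃ t + f₃ t′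
    F₂ us@(_ ∷ _ ∷ _ ∷ _) = minList (pick2 (map (λ t → (f₁ t , f₃ t)) us))
    F₃ : List Triple → ℕ
    F₃ [] = 0   -- does not occur: cutpoint nodes have children
    F₃ (t ∷ []) = f₃ t
    F₃ us@(_ ∷ _ ∷ _) = minList (pick1 (map (λ t → (f₁ t , f₃ t)) us))

combineB : ℕ → List Triple → Triple
combineB sb [] = ⟨ sb , 0 , 0 ⟩
combineB sb ts@(_ ∷ _) =
  ⟨ sb + sum (map f₁ ts)
  , sum (map (λ t → f₁ t ⊓ f₃ t) ts)
      ⊓ minList (map (sb +_) (pick1 (map (λ t → (f₁ t , f₂ t)) ts)))
  , sum (map (λ t → f₁ t ⊓ f₃ t) ts) ⟩

module _ {n : ℕ} (w : Fin n → ℕ) (s : Subset n → ℕ) where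
  mutual
    fC : CNode n → Triple
    fC (cnode v bs) = combineC (w v) (fBs bs)
    fBs : List (BNode n) → List Triple
    fBs [] = []
    fBs (b ∷ bs) = fB b ∷ fBs bs
    fB : BNode n → Triple
    fB (bnode B cs) = combineB (s B) (fCs cs)
    fCs : List (CNode n) → List Triple
    fCs [] = []
    fCs (c ∷ cs) = fC c ∷ fCs cs

  fRoot : CNode n → ℕ
  fRoot T = f₁ (fC T) ⊓ f₂ (fC T)

IsMinClawDeletionWeight : ∀ {n} → Graph n → (Fin n → ℕ) → ℕ → Set
IsMinClawDeletionWeight {n} G w k =
    Σ (Subset n) (λ S → ClawDeletionSet G S × weight w S ≡ k)
  × (∀ S → ClawDeletionSet G S → k ≤ weight w S)

module Submission where

-- In a block graph, vertices other than a of two distinct blocks through a are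
-- distinct and non-adjacent, while a is adjacent to everything in its blocks.
-- Hence a kept vertex a is the centre of a claw exactly when three blocks
-- through a keep a vertex other than a, and such an a lies in two blocks, so
-- it is a cutpoint: S is a claw-deletion set iff every kept cutpoint has at
-- most two "active" blocks. This condition is local in the block-cutpoint tree.
-- At a node of the rooted tree f₁, f₂, f₃ are the least weights to delete in
-- its subtree under three regimes for the node and its parent: a cutpoint is
-- deleted / kept with its parent block inactive / kept; a block has all its
-- vertices but the parent deleted / its parent deleted / its parent kept.
-- By induction over the tree, every claw-deletion set costs at least f_i in each
-- subtree whose regime it satisfies, and in every regime the children's optimal
-- sets combine into a deletion set of weight f_i.

open import Defs
open import Data.Bool using (Bool; true; false; _∧_; _∨_; not; if_then_else_) renaming (_≟_ to _≟ᵇ_)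
open import Data.Bool.Properties using (¬-not)
open import Data.Empty using (⊥; ⊥-elim)
open import Data.Fin using (Fin)
open import Data.Fin.Properties using (any?; all?) renaming (_≟_ to _≟ᶠ_)
open import Data.Fin.Subset using (Subset; _∈_; _∉_; _⊆_; _⊂_; ∣_∣; _∪_; ⁅_⁆)
open import Data.Fin.Subset.Properties
  using (_∈?_; _⊂?_; anySubset?; p⊆p∪q; q⊆p∪q; x∈p∪q⁻; ⊆-antisym; p⊂q⇒∣p∣<∣q∣; p⊆q⇒∣p∣≤∣q∣; ∣p∣≤n)
  using (x∈⁅x⁆; x∈⁅y⁆⇒x≡y; ∣⁅x⁆∣≡1)
open import Data.List using (List; []; _∷_; _++_; map; foldr; concatMap; length; allFin)
open import Data.List.Membership.Propositional using () renaming (_∈_ to _∈ᴸ_; _∉_ to _∉ᴸ_)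
open import Data.List.Membership.Propositional.Properties using (∈-++⁺ˡ; ∈-++⁺ʳ; ∈-++⁻; ∈-map⁺; ∈-map⁻; ∈-allFin)
open import Data.List.Properties using (map-++; map-cong)
open import Data.List.Relation.Binary.Sublist.Propositional
  using ([]; _∷_; _∷ʳ_; minimum) renaming (_⊆_ to _⊆ᴸ_; lookup to lookup-⊆ᴸ)
import Data.List.Relation.Binary.Sublist.Propositional.Properties as Sublist
open import Data.List.Relation.Unary.All as All using (All; []; _∷_)
open import Data.List.Relation.Unary.Any using (here; there)
open import Data.List.Relation.Unary.Unique.Propositional using (Unique; []; _∷_)
open import Data.List.Relation.Unary.Unique.Propositional.Properties using (Unique[x∷xs]⇒x∉xs; allFin⁺)
open import Data.Maybe using (Maybe; just; nothing)
open import Data.Nat using (ℕ; zero; suc; _+_; _≤_; _<_; _⊓_; z≤n)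
import Data.Nat.Properties as ℕ
open import Algebra.Properties.CommutativeSemigroup ℕ.+-commutativeSemigroup
  using () renaming (interchange to +-interchange; x∙yz≈y∙xz to +-exchange)
open import Data.Nat.ListAction using (sum)
open import Data.Nat.ListAction.Properties using (sum-++)
open import Data.Product using (Σ; ∃; _×_; _,_; proj₁; proj₂)
open import Data.Sum using (_⊎_; inj₁; inj₂)
open import Data.Unit using (tt)
open import Data.Vec using (lookup; tabulate)
open import Data.Vec.Properties using ([]=⇒lookup; lookup⇒[]=; lookup∘tabulate)
open import Function.Bundles using (_⇔_; Equivalence)
open import Relation.Nullary using (¬_; Dec; yes; no; does)
open import Relation.Nullary.Decidable using (dec-true; map′; _⊎-dec_; _×-dec_; _→-dec_; ¬?)
open import Relation.Binary.PropositionalEquality using (_≡_; _≢_; refl; sym; trans; cong; cong₂; subst; module ≡-Reasoning)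

module _ {A : Set} where

  Unique-++⁻ˡ : ∀ xs {ys : List A} → Unique (xs ++ ys) → Unique xs
  Unique-++⁻ˡ []       _        = []
  Unique-++⁻ˡ (_ ∷ xs) (x∉ ∷ u) = All.tabulate (λ x∈ → All.lookup x∉ (∈-++⁺ˡ x∈)) ∷ Unique-++⁻ˡ xs u

  Unique-++⁻ʳ : ∀ xs {ys : List A} → Unique (xs ++ ys) → Unique ys
  Unique-++⁻ʳ []       u       = u
  Unique-++⁻ʳ (_ ∷ xs) (_ ∷ u) = Unique-++⁻ʳ xs u

  Unique-++-disjoint : ∀ xs {ys : List A} {a} → Unique (xs ++ ys) → a ∈ᴸ xs → a ∉ᴸ ys
  Unique-++-disjoint (_ ∷ xs) (x∉ ∷ _) (here refl) a∈ys = All.lookup x∉ (∈-++⁺ʳ xs a∈ys) refl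
  Unique-++-disjoint (_ ∷ xs) (_ ∷ u)  (there a∈)  a∈ys = Unique-++-disjoint xs u a∈ a∈ys

module _ {X A : Set} {g : X → List A} where

  ∈-concatMap : ∀ {xs x a} → x ∈ᴸ xs → a ∈ᴸ g x → a ∈ᴸ concatMap g xs
  ∈-concatMap {x ∷ xs} (here refl) a∈ = ∈-++⁺ˡ a∈
  ∈-concatMap {y ∷ xs} (there x∈)  a∈ = ∈-++⁺ʳ (g y) (∈-concatMap x∈ a∈)

  ∈-concatMap⁻ : ∀ xs {a} → a ∈ᴸ concatMap g xs → ∃ λ x → x ∈ᴸ xs × a ∈ᴸ g x
  ∈-concatMap⁻ (x ∷ xs) a∈ with ∈-++⁻ (g x) a∈
  ... | inj₁ a∈x  = x , here refl , a∈x
  ... | inj₂ a∈xs with ∈-concatMap⁻ xs a∈xs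
  ...   | y , y∈ , a∈y = y , there y∈ , a∈y

  Unique-concatMap⁻ : ∀ {xs x} → Unique (concatMap g xs) → x ∈ᴸ xs → Unique (g x)
  Unique-concatMap⁻ {y ∷ xs} u (here refl) = Unique-++⁻ˡ (g y) u
  Unique-concatMap⁻ {y ∷ xs} u (there x∈) = Unique-concatMap⁻ (Unique-++⁻ʳ (g y) u) x∈

  concatMap-owner : ∀ {xs x y a} → Unique (concatMap g xs) → x ∈ᴸ xs → y ∈ᴸ xs
    → a ∈ᴸ g x → a ∈ᴸ g y → x ≡ y
  concatMap-owner     _ (here refl) (here refl) _ _ = refl
  concatMap-owner {z ∷ xs} u (here refl) (there y∈) a∈x a∈y =
    ⊥-elim (Unique-++-disjoint (g z) u a∈x (∈-concatMap y∈ a∈y))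
  concatMap-owner {z ∷ xs} u (there x∈) (here refl) a∈x a∈y =
    ⊥-elim (Unique-++-disjoint (g z) u a∈y (∈-concatMap x∈ a∈x))
  concatMap-owner {z ∷ xs} u (there x∈) (there y∈) a∈x a∈y =
    concatMap-owner (Unique-++⁻ʳ (g z) u) x∈ y∈ a∈x a∈y

  Unique-map-representative : {h : X → A} → (∀ x → h x ∈ᴸ g x)
    → ∀ {xs} → Unique (concatMap g xs) → Unique (map h xs)
  Unique-map-representative         hg {[]}     _ = []
  Unique-map-representative {h = h} hg {x ∷ xs} u =
    All.tabulate distinct ∷ Unique-map-representative hg (Unique-++⁻ʳ (g x) u)
    where
      distinct : ∀ {a} → a ∈ᴸ map h xs → h x ≢ a
      distinct a∈ refl with ∈-map⁻ h a∈
      ... | y , y∈ , e = Unique-++-disjoint (g x) u (hg x)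
                           (∈-concatMap y∈ (subst (_∈ᴸ g y) (sym e) (hg y)))

∈-++-∷⁻ : ∀ {A : Set} xs {x ys} {y : A} → y ∈ᴸ xs ++ x ∷ ys → y ≡ x ⊎ y ∈ᴸ xs ++ ys
∈-++-∷⁻ []       (here e)   = inj₁ e
∈-++-∷⁻ []       (there y∈) = inj₂ y∈
∈-++-∷⁻ (_ ∷ xs) (here e)   = inj₂ (here e)
∈-++-∷⁻ (_ ∷ xs) (there y∈) with ∈-++-∷⁻ xs y∈
... | inj₁ e   = inj₁ e
... | inj₂ y∈′ = inj₂ (there y∈′)

All-++-∷⁻ : ∀ {A : Set} {P : A → Set} xs {x ys} → All P (xs ++ x ∷ ys) → P x × All P (xs ++ ys)
All-++-∷⁻ []       (px ∷ pys) = px , pys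
All-++-∷⁻ (_ ∷ xs) (py ∷ ps)  with All-++-∷⁻ xs ps
... | px , rest = px , py ∷ rest

∈-++-∷-++-∷⁻ : ∀ {A : Set} xs₁ {x xs₂ z xs₃} {y : A} → y ∈ᴸ xs₁ ++ x ∷ xs₂ ++ z ∷ xs₃
  → y ≡ x ⊎ y ≡ z ⊎ y ∈ᴸ xs₁ ++ xs₂ ++ xs₃
∈-++-∷-++-∷⁻ []                    (here e)   = inj₁ e
∈-++-∷-++-∷⁻ []        {xs₂ = xs₂} (there y∈) = inj₂ (∈-++-∷⁻ xs₂ y∈)
∈-++-∷-++-∷⁻ (_ ∷ xs₁) (here e)   = inj₂ (inj₂ (here e))
∈-++-∷-++-∷⁻ (_ ∷ xs₁) (there y∈) with ∈-++-∷-++-∷⁻ xs₁ y∈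
... | inj₁ e          = inj₁ e
... | inj₂ (inj₁ e)   = inj₂ (inj₁ e)
... | inj₂ (inj₂ y∈′) = inj₂ (inj₂ (there y∈′))

All-++-∷-++-∷⁻ : ∀ {A : Set} {P : A → Set} xs₁ {x xs₂ z xs₃} → All P (xs₁ ++ x ∷ xs₂ ++ z ∷ xs₃)
  → P x × P z × All P (xs₁ ++ xs₂ ++ xs₃)
All-++-∷-++-∷⁻ []        {xs₂ = xs₂} (px ∷ ps) with All-++-∷⁻ xs₂ ps
... | pz , rest = px , pz , rest
All-++-∷-++-∷⁻ (_ ∷ xs₁) (py ∷ ps) with All-++-∷-++-∷⁻ xs₁ ps
... | px , pz , rest = px , pz , py ∷ rest

minList-≤ : ∀ {x xs} → x ∈ᴸ xs → minList xs ≤ x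
minList-≤ {xs = y ∷ ys} = go y ys
  where
    go : ∀ y ys {x} → x ∈ᴸ y ∷ ys → foldr _⊓_ y ys ≤ x
    go y []       (here refl)         = ℕ.≤-refl
    go y (z ∷ zs) (here refl)         = ℕ.≤-trans (ℕ.m⊓n≤n z _) (go y zs (here refl))
    go y (z ∷ zs) (there (here refl)) = ℕ.m⊓n≤m z _
    go y (z ∷ zs) (there (there x∈)) = ℕ.≤-trans (ℕ.m⊓n≤n z _) (go y zs (there x∈))

minList-∈ : ∀ y ys → minList (y ∷ ys) ∈ᴸ y ∷ ys
minList-∈ y []       = here refl
minList-∈ y (z ∷ zs) with ℕ.⊓-sel z (foldr _⊓_ y zs)
... | inj₁ e rewrite e = there (here refl)
... | inj₂ e rewrite e with minList-∈ y zs
...   | here  e′ = here e′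
...   | there m  = there (there m)

Unique-resp-⊇ : ∀ {A : Set} {xs ys : List A} → xs ⊆ᴸ ys → Unique ys → Unique xs
Unique-resp-⊇ []         []        = []
Unique-resp-⊇ (_ ∷ʳ τ)   (_ ∷ u)   = Unique-resp-⊇ τ u
Unique-resp-⊇ (refl ∷ τ) (y∉ ∷ u)  = Sublist.All-resp-⊆ τ y∉ ∷ Unique-resp-⊇ τ u

Unique₂⇒≢ : ∀ {A : Set} {x y : A} → Unique (x ∷ y ∷ []) → x ≢ y
Unique₂⇒≢ ((x≢y ∷ []) ∷ _) = x≢y

Unique₃⇒≢ : ∀ {A : Set} {x y z : A} → Unique (x ∷ y ∷ z ∷ []) → x ≢ y × x ≢ z × y ≢ z
Unique₃⇒≢ ((x≢y ∷ x≢z ∷ []) ∷ (y≢z ∷ []) ∷ _) = x≢y , x≢z , y≢z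

sum-map-++ : ∀ {X : Set} (f : X → ℕ) xs ys → sum (map f (xs ++ ys)) ≡ sum (map f xs) + sum (map f ys)
sum-map-++ f xs ys = trans (cong sum (map-++ f xs ys)) (sum-++ (map f xs) (map f ys))

-- pick1 and pick2 enumerate the ways of choosing one (two) of the elements
-- to be charged c and all others to be charged a.
module Selection {X : Set} (a c : X → ℕ) where

  pairs : List X → List (ℕ × ℕ)
  pairs = map (λ x → (a x , c x))

  Σa : List X → ℕ
  Σa xs = sum (map a xs)

  private
    Σproj₁-pairs : ∀ xs → sum (map proj₁ (pairs xs)) ≡ Σa xs
    Σproj₁-pairs []       = refl
    Σproj₁-pairs (x ∷ xs) = cong (a x +_) (Σproj₁-pairs xs)

  pick1-split : ∀ xs {e} → e ∈ᴸ pick1 (pairs xs) →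
    Σ (List X) λ xs₁ → Σ X λ x → Σ (List X) λ xs₂ → xs ≡ xs₁ ++ x ∷ xs₂ × e ≡ c x + Σa (xs₁ ++ xs₂)
  pick1-split (x ∷ xs) (here e)  = [] , x , xs , refl , trans e (cong (c x +_) (Σproj₁-pairs xs))
  pick1-split (x ∷ xs) (there m) with ∈-map⁻ (a x +_) m
  ... | _ , m′ , refl with pick1-split xs m′
  ...   | ys₁ , y , ys₂ , refl , refl = x ∷ ys₁ , y , ys₂ , refl , +-exchange (a x) (c y) _

  pick2-split : ∀ xs {e} → e ∈ᴸ pick2 (pairs xs) →
    Σ (List X) λ xs₁ → Σ X λ x → Σ (List X) λ xs₂ → Σ X λ y → Σ (List X) λ xs₃ →
      xs ≡ xs₁ ++ x ∷ xs₂ ++ y ∷ xs₃ × e ≡ c x + (c y + Σa (xs₁ ++ xs₂ ++ xs₃))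
  pick2-split (x ∷ xs) m with ∈-++⁻ (map (c x +_) (pick1 (pairs xs))) m
  ... | inj₁ m′ with ∈-map⁻ (c x +_) m′
  ...   | _ , m″ , refl with pick1-split xs m″
  ...     | ys₁ , y , ys₂ , refl , refl = [] , x , ys₁ , y , ys₂ , refl , refl
  pick2-split (x ∷ xs) m | inj₂ m′ with ∈-map⁻ (a x +_) m′
  ...   | _ , m″ , refl with pick2-split xs m″
  ...     | ys₁ , y , ys₂ , z , ys₃ , refl , refl =
    x ∷ ys₁ , y , ys₂ , z , ys₃ , refl , trans (+-exchange (a x) (c y) _) (cong (c y +_) (+-exchange (a x) (c z) _))

  minList-pick1-split : ∀ x xs →
    Σ (List X) λ xs₁ → Σ X λ x′ → Σ (List X) λ xs₂ →
      x ∷ xs ≡ xs₁ ++ x′ ∷ xs₂ × minList (pick1 (pairs (x ∷ xs))) ≡ c x′ + Σa (xs₁ ++ xs₂)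
  minList-pick1-split x xs = pick1-split (x ∷ xs) (minList-∈ _ _)

  minList-pick2-split : ∀ x y zs →
    Σ (List X) λ xs₁ → Σ X λ x′ → Σ (List X) λ xs₂ → Σ X λ y′ → Σ (List X) λ xs₃ →
      x ∷ y ∷ zs ≡ xs₁ ++ x′ ∷ xs₂ ++ y′ ∷ xs₃
      × minList (pick2 (pairs (x ∷ y ∷ zs))) ≡ c x′ + (c y′ + Σa (xs₁ ++ xs₂ ++ xs₃))
  minList-pick2-split x y zs = pick2-split (x ∷ y ∷ zs) (minList-∈ _ _)

  module _ (k : X → ℕ) where

    Σk : List X → ℕ
    Σk xs = sum (map k xs)

    data Dominated : ℕ → List X → Set where
      []  : ∀ {m} → Dominated m []
      _∷ᵃ_ : ∀ {m x xs} → a x ≤ k x → Dominated m xs → Dominated m (x ∷ xs)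
      _∷ᶜ_ : ∀ {m x xs} → c x ≤ k x → Dominated m xs → Dominated (suc m) (x ∷ xs)

    dominated₀ : ∀ {xs} → Dominated 0 xs → All (λ x → a x ≤ k x) xs
    dominated₀ []          = []
    dominated₀ (ax ∷ᵃ dom) = ax ∷ dominated₀ dom

    Σa-≤ : ∀ {xs} → Dominated 0 xs → Σa xs ≤ Σk xs
    Σa-≤ []          = z≤n
    Σa-≤ (ax ∷ᵃ dom) = ℕ.+-mono-≤ ax (Σa-≤ dom)

    private
      Entry≤ : List ℕ → List X → Set
      Entry≤ es xs = Σ ℕ λ e → e ∈ᴸ es × e ≤ Σk xs

      first-entry : ∀ x xs → c x ≤ k x → Dominated 0 xs → Entry≤ (pick1 (pairs (x ∷ xs))) (x ∷ xs)
      first-entry x xs cx dom = _ , here refl ,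
        ℕ.+-mono-≤ cx (ℕ.≤-trans (ℕ.≤-reflexive (Σproj₁-pairs xs)) (Σa-≤ dom))

      pick1-entry : ∀ {xs} → Dominated 1 xs → Dominated 0 xs ⊎ Entry≤ (pick1 (pairs xs)) xs
      pick1-entry [] = inj₁ []
      pick1-entry (ax ∷ᵃ dom) with pick1-entry dom
      ... | inj₁ dom₀           = inj₁ (ax ∷ᵃ dom₀)
      ... | inj₂ (e , e∈ , le) = inj₂ (_ , there (∈-map⁺ _ e∈) , ℕ.+-mono-≤ ax le)
      pick1-entry {x ∷ xs} (cx ∷ᶜ dom) = inj₂ (first-entry x xs cx dom)

      pick1-entry′ : ∀ x xs → c x ≤ k x → Dominated 1 (x ∷ xs) → Entry≤ (pick1 (pairs (x ∷ xs))) (x ∷ xs)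
      pick1-entry′ x xs cx dom with pick1-entry dom
      ... | inj₁ (_ ∷ᵃ dom₀) = first-entry x xs cx dom₀
      ... | inj₂ entry       = entry

      pick2-entry : ∀ x y zs → All (λ u → c u ≤ k u) (x ∷ y ∷ zs) → Dominated 2 (x ∷ y ∷ zs)
        → Entry≤ (pick2 (pairs (x ∷ y ∷ zs))) (x ∷ y ∷ zs)
      pick2-entry x y zs (_ ∷ cy ∷ _) (cx ∷ᶜ dom) with pick1-entry′ y zs cy dom
      ... | e , e∈ , le = _ , ∈-++⁺ˡ (∈-map⁺ (c x +_) e∈) , ℕ.+-mono-≤ cx le
      pick2-entry x y [] (cx ∷ cy ∷ []) (_ ∷ᵃ _) = _ , here refl , ℕ.+-mono-≤ cx (ℕ.+-mono-≤ cy z≤n)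
      pick2-entry x y (z ∷ zs) (_ ∷ cs) (ax ∷ᵃ dom) with pick2-entry y z zs cs dom
      ... | e , e∈ , le =
        _ , ∈-++⁺ʳ (map (c x +_) (pick1 (pairs (y ∷ z ∷ zs)))) (∈-map⁺ (a x +_) e∈) , ℕ.+-mono-≤ ax le

    minList-pick1-≤ : ∀ {xs} → Dominated 1 xs → Dominated 0 xs ⊎ minList (pick1 (pairs xs)) ≤ Σk xs
    minList-pick1-≤ dom with pick1-entry dom
    ... | inj₁ dom₀          = inj₁ dom₀
    ... | inj₂ (_ , e∈ , le) = inj₂ (ℕ.≤-trans (minList-≤ e∈) le)

    minList-pick1-≤′ : ∀ x xs → c x ≤ k x → Dominated 1 (x ∷ xs) → minList (pick1 (pairs (x ∷ xs))) ≤ Σk (x ∷ xs)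
    minList-pick1-≤′ x xs cx dom with pick1-entry′ x xs cx dom
    ... | _ , e∈ , le = ℕ.≤-trans (minList-≤ e∈) le

    minList-pick2-≤ : ∀ x y zs → All (λ u → c u ≤ k u) (x ∷ y ∷ zs) → Dominated 2 (x ∷ y ∷ zs)
      → minList (pick2 (pairs (x ∷ y ∷ zs))) ≤ Σk (x ∷ y ∷ zs)
    minList-pick2-≤ x y zs cs dom with pick2-entry x y zs cs dom
    ... | _ , e∈ , le = ℕ.≤-trans (minList-≤ e∈) le

    dominated-or-active : ∀ {Active : X → Set} → (∀ x → Dec (Active x)) → ∀ m xs
      → (∀ {x} → x ∈ᴸ xs → ¬ Active x → a x ≤ k x) → (∀ {x} → x ∈ᴸ xs → Active x → c x ≤ k x)
      → Dominated m xs ⊎ Σ (List X) λ ys → ys ⊆ᴸ xs × All Active ys × length ys ≡ suc m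
    dominated-or-active active? m [] _ _ = inj₁ []
    dominated-or-active active? m (x ∷ xs) inactive-a active-c with active? x
    ... | no ¬act with dominated-or-active active? m xs (λ x∈ → inactive-a (there x∈)) (λ x∈ → active-c (there x∈))
    ...   | inj₁ dom                  = inj₁ (inactive-a (here refl) ¬act ∷ᵃ dom)
    ...   | inj₂ (ys , τ , acts , len) = inj₂ (ys , x ∷ʳ τ , acts , len)
    dominated-or-active active? zero (x ∷ xs) _ _ | yes act =
      inj₂ (x ∷ [] , refl ∷ minimum xs , act ∷ [] , refl)
    dominated-or-active active? (suc m) (x ∷ xs) inactive-a active-c | yes act
      with dominated-or-active active? m xs (λ x∈ → inactive-a (there x∈)) (λ x∈ → active-c (there x∈))
    ... | inj₁ dom                  = inj₁ (active-c (here refl) act ∷ᶜ dom)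
    ... | inj₂ (ys , τ , acts , len) = inj₂ (x ∷ ys , refl ∷ τ , act ∷ acts , cong suc len)

minList-map-+ : ∀ a xs → minList (map (a +_) xs) ≤ a + minList xs
minList-map-+ a []       = z≤n
minList-map-+ a (y ∷ ys) = minList-≤ (∈-map⁺ (a +_) (minList-∈ y ys))

minList-map-+-attained : ∀ a xs → xs ≡ [] ⊎ Σ ℕ λ e → e ∈ᴸ xs × minList (map (a +_) xs) ≡ a + e
minList-map-+-attained a []       = inj₁ refl
minList-map-+-attained a (y ∷ ys) with ∈-map⁻ (a +_) (minList-∈ (a + y) (map (a +_) ys))
... | e , e∈ , min≡ = inj₂ (e , e∈ , min≡)

module _ {X : Set} where

  sum-map-mono : ∀ {g h : X → ℕ} xs → (∀ x → g x ≤ h x) → sum (map g xs) ≤ sum (map h xs)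
  sum-map-mono []       _   = z≤n
  sum-map-mono (x ∷ xs) g≤h = ℕ.+-mono-≤ (g≤h x) (sum-map-mono xs g≤h)

  sum-map-cong : ∀ {g h : X → ℕ} xs → (∀ x → g x ≡ h x) → sum (map g xs) ≡ sum (map h xs)
  sum-map-cong xs g≡h = cong sum (map-cong g≡h xs)

  sum-map-zero : ∀ (g : X → ℕ) xs → (∀ {x} → x ∈ᴸ xs → g x ≡ 0) → sum (map g xs) ≡ 0
  sum-map-zero g []       _    = refl
  sum-map-zero g (x ∷ xs) zeros = cong₂ _+_ (zeros (here refl)) (sum-map-zero g xs (λ x∈ → zeros (there x∈)))

  sum-map-+ : ∀ (g h : X → ℕ) xs → sum (map (λ x → g x + h x) xs) ≡ sum (map g xs) + sum (map h xs)
  sum-map-+ g h []       = refl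
  sum-map-+ g h (x ∷ xs) = trans (cong (g x + h x +_) (sum-map-+ g h xs)) (+-interchange (g x) (h x) _ _)

  sum-map-mono-All : ∀ {g h : X → ℕ} xs → All (λ x → g x ≤ h x) xs → sum (map g xs) ≤ sum (map h xs)
  sum-map-mono-All []       []         = z≤n
  sum-map-mono-All (x ∷ xs) (le ∷ les) = ℕ.+-mono-≤ le (sum-map-mono-All xs les)

  term-≤-sum : ∀ (g : X → ℕ) {x xs} → x ∈ᴸ xs → g x ≤ sum (map g xs)
  term-≤-sum g {xs = y ∷ _} (here refl) = ℕ.m≤m+n (g y) _
  term-≤-sum g {xs = y ∷ _} (there x∈)  = ℕ.≤-trans (term-≤-sum g x∈) (ℕ.m≤n+m _ (g y))

  sum-at-most-one : ∀ (p : X → Bool) (c : ℕ) xs → Unique xs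
    → (∀ {x y} → x ∈ᴸ xs → y ∈ᴸ xs → x ≢ y → p x ≡ true → p y ≡ true → ⊥)
    → sum (map (λ x → if p x then c else 0) xs) ≤ c
  sum-at-most-one p c []       _          _   = z≤n
  sum-at-most-one p c (x ∷ xs) (x∉ ∷ u) one with p x in px
  ... | true  = ℕ.≤-reflexive (trans (cong (c +_) (sum-map-zero _ xs rest-zero)) (ℕ.+-identityʳ c))
    where
      rest-zero : ∀ {y} → y ∈ᴸ xs → (if p y then c else 0) ≡ 0
      rest-zero {y} y∈ with p y in py
      ... | true  = ⊥-elim (one (here refl) (there y∈) (All.lookup x∉ y∈) px py)
      ... | false = refl
  ... | false = sum-at-most-one p c xs u (λ x∈ y∈ → one (there x∈) (there y∈))

sum-map-swap : ∀ {X Y : Set} (g : X → Y → ℕ) xs ys →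
  sum (map (λ x → sum (map (g x) ys)) xs) ≡ sum (map (λ y → sum (map (λ x → g x y) xs)) ys)
sum-map-swap g []       ys = sym (sum-map-zero (λ _ → 0) ys (λ _ → refl))
sum-map-swap g (x ∷ xs) ys =
  trans (cong (sum (map (g x) ys) +_) (sum-map-swap g xs ys))
        (sym (sum-map-+ (g x) (λ y → sum (map (λ x → g x y) xs)) ys))

does⇒ : ∀ {A : Set} (d : Dec A) → does d ≡ true → A
does⇒ (yes a) _ = a

true≢false : true ≢ false
true≢false ()

∈-tabulate⁺ : ∀ {n} {f : Fin n → Bool} {x} → f x ≡ true → x ∈ tabulate f
∈-tabulate⁺ {f = f} {x} e = lookup⇒[]= x _ (trans (lookup∘tabulate f x) e)

∈-tabulate⁻ : ∀ {n} {f : Fin n → Bool} {x} → x ∈ tabulate f → f x ≡ true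
∈-tabulate⁻ {f = f} {x} m = trans (sym (lookup∘tabulate f x)) ([]=⇒lookup m)

-- fuel for iterations that strictly grow a subset of Fin n
no-fuel : ∀ {n} {A : Set} (p : Subset n) → n < ∣ p ∣ + 0 → A
no-fuel p lt = ⊥-elim (ℕ.<-irrefl refl (ℕ.≤-trans lt (ℕ.≤-trans (ℕ.≤-reflexive (ℕ.+-identityʳ _)) (∣p∣≤n p))))

⊂-fuel : ∀ {n} {p q : Subset n} k → n < ∣ p ∣ + suc k → p ⊂ q → n < ∣ q ∣ + k
⊂-fuel k lt p⊂q =
  ℕ.≤-trans lt (ℕ.≤-trans (ℕ.≤-reflexive (ℕ.+-suc _ k)) (ℕ.+-monoˡ-≤ k (p⊂q⇒∣p∣<∣q∣ p⊂q)))

other-than : ∀ {n} {a b : Fin n} → a ≢ b → ∀ z → Σ (Fin n) λ h → (h ≡ a ⊎ h ≡ b) × h ≢ z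
other-than {a = a} {b} a≢b z with a ≟ᶠ z
... | yes refl = b , inj₂ refl , λ b≡a → a≢b (sym b≡a)
... | no  a≢z  = a , inj₁ refl , a≢z

one-of : ∀ {A : Set} {P : A → Set} {a b h} → h ≡ a ⊎ h ≡ b → P a → P b → P h
one-of (inj₁ refl) pa _  = pa
one-of (inj₂ refl) _  pb = pb

module _ {n : ℕ} (G : Graph n) where

  adj-sym : ∀ {x y} → Adj G x y → Adj G y x
  adj-sym {x} {y} a = trans (Graph.sym G y x) a

  adj-irrefl : ∀ {x y} → Adj G x y → x ≢ y
  adj-irrefl {x} a refl with trans (sym a) (Graph.irrefl G x)
  ... | ()

  reach-start : ∀ {P x y} → Reach G P x y → P x
  reach-start (here p)     = p
  reach-start (step r _ _) = reach-start r

  reach-end : ∀ {P x y} → Reach G P x y → P y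
  reach-end (here p)     = p
  reach-end (step _ _ p) = p

  reach-mono : ∀ {P Q : Fin n → Set} → (∀ {u} → P u → Q u) → ∀ {x y} → Reach G P x y → Reach G Q x y
  reach-mono f (here p)     = here (f p)
  reach-mono f (step r a p) = step (reach-mono f r) a (f p)

  reach-trans : ∀ {P x y z} → Reach G P x y → Reach G P y z → Reach G P x z
  reach-trans r (here _)      = r
  reach-trans r (step r′ a p) = step (reach-trans r r′) a p

  reach-edge : ∀ {P x y} → P x → Adj G x y → P y → Reach G P x y
  reach-edge px a py = step (here px) a py

  reach-sym : ∀ {P x y} → Reach G P x y → Reach G P y x
  reach-sym (here p)     = here p
  reach-sym (step r a p) = reach-trans (reach-edge p (adj-sym a) (reach-end r)) (reach-sym r)

  connectedOn-hub : ∀ {Q} c → (∀ x → Q x → Reach G Q x c) → ConnectedOn G Q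
  connectedOn-hub c h x y qx qy = reach-trans (h x qx) (reach-sym (h y qy))

  biconnected-avoiding : ∀ {B} → Biconnected G B → ∀ z → ConnectedOn G (λ u → u ∈ B × u ≢ z)
  biconnected-avoiding {B} (_ , c , d) z with z ∈? B
  ... | yes z∈ = d z z∈
  ... | no  z∉ = λ x y px py →
    reach-mono (λ u∈ → u∈ , λ { refl → z∉ u∈ }) (c x y (proj₁ px) (proj₁ py))

  biconnected-via-hubs : ∀ {B a b} → 2 ≤ ∣ B ∣ → a ≢ b
    → (∀ x → x ∈ B → Reach G (_∈ B) x a)
    → (∀ z h → h ≡ a ⊎ h ≡ b → h ≢ z → ∀ x → x ∈ B → x ≢ z → Reach G (λ u → u ∈ B × u ≢ z) x h)
    → Biconnected G B
  biconnected-via-hubs {B} {a} {b} size a≢b to-a to-hub =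
    size , connectedOn-hub a to-a , λ z _ → via (other-than a≢b z)
    where
      via : ∀ {z} → (Σ (Fin n) λ h → (h ≡ a ⊎ h ≡ b) × h ≢ z) → ConnectedOn G (λ u → u ∈ B × u ≢ z)
      via {z} (h , h-ab , h≢z) = connectedOn-hub h (λ x (x∈ , x≢z) → to-hub z h h-ab h≢z x x∈ x≢z)

  biconnected-∪ : ∀ {B₁ B₂ a b} → Biconnected G B₁ → Biconnected G B₂ → a ≢ b
    → a ∈ B₁ → b ∈ B₁ → a ∈ B₂ → b ∈ B₂ → Biconnected G (B₁ ∪ B₂)
  biconnected-∪ {B₁} {B₂} {a} {b} bc₁@(s₁ , c₁ , _) bc₂@(_ , c₂ , _) a≢b a₁ b₁ a₂ b₂ =
    biconnected-via-hubs (ℕ.≤-trans s₁ (p⊆q⇒∣p∣≤∣q∣ (p⊆p∪q {p = B₁} B₂))) a≢b to-a to-hub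
    where
      to-a : ∀ x → x ∈ B₁ ∪ B₂ → Reach G (_∈ B₁ ∪ B₂) x a
      to-a x x∈ with x∈p∪q⁻ B₁ B₂ x∈
      ... | inj₁ x₁ = reach-mono (p⊆p∪q B₂) (c₁ x a x₁ a₁)
      ... | inj₂ x₂ = reach-mono (q⊆p∪q B₁ B₂) (c₂ x a x₂ a₂)
      to-hub : ∀ z h → h ≡ a ⊎ h ≡ b → h ≢ z → ∀ x → x ∈ B₁ ∪ B₂ → x ≢ z
        → Reach G (λ u → u ∈ B₁ ∪ B₂ × u ≢ z) x h
      to-hub z h h-ab h≢z x x∈ x≢z with x∈p∪q⁻ B₁ B₂ x∈
      ... | inj₁ x₁ = reach-mono (λ (u∈ , u≢z) → p⊆p∪q B₂ u∈ , u≢z)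
                        (biconnected-avoiding bc₁ z x h (x₁ , x≢z) (one-of h-ab a₁ b₁ , h≢z))
      ... | inj₂ x₂ = reach-mono (λ (u∈ , u≢z) → q⊆p∪q B₁ B₂ u∈ , u≢z)
                        (biconnected-avoiding bc₂ z x h (x₂ , x≢z) (one-of h-ab a₂ b₂ , h≢z))

  block-≡ : ∀ {B₁ B₂ a b} → IsBlock G B₁ → IsBlock G B₂ → a ≢ b
    → a ∈ B₁ → b ∈ B₁ → a ∈ B₂ → b ∈ B₂ → B₁ ≡ B₂
  block-≡ {B₁} {B₂} (bc₁ , max₁) (bc₂ , max₂) a≢b a₁ b₁ a₂ b₂ =
    ⊆-antisym (λ x∈ → max₂ _ (q⊆p∪q B₁ B₂) ∪-bc (p⊆p∪q B₂ x∈))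
              (λ x∈ → max₁ _ (p⊆p∪q B₂) ∪-bc (q⊆p∪q B₁ B₂ x∈))
    where
      ∪-bc : Biconnected G (B₁ ∪ B₂)
      ∪-bc = biconnected-∪ bc₁ bc₂ a≢b a₁ b₁ a₂ b₂

  biconnected-∪-⁅⁆ : ∀ {B a b y} → Biconnected G B → a ≢ b → a ∈ B → b ∈ B
    → Adj G y a → Adj G y b → Biconnected G (B ∪ ⁅ y ⁆)
  biconnected-∪-⁅⁆ {B} {a} {b} {y} bc@(s , c , _) a≢b a∈ b∈ ya yb =
    biconnected-via-hubs (ℕ.≤-trans s (p⊆q⇒∣p∣≤∣q∣ (p⊆p∪q {p = B} ⁅ y ⁆))) a≢b to-a to-hub
    where
      to-a : ∀ x → x ∈ B ∪ ⁅ y ⁆ → Reach G (_∈ B ∪ ⁅ y ⁆) x a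
      to-a x x∈ with x∈p∪q⁻ B ⁅ y ⁆ x∈
      ... | inj₁ x∈B = reach-mono (p⊆p∪q ⁅ y ⁆) (c x a x∈B a∈)
      ... | inj₂ x∈y with x∈⁅y⁆⇒x≡y y x∈y
      ...   | refl = reach-edge x∈ ya (p⊆p∪q ⁅ y ⁆ a∈)
      to-hub : ∀ z h → h ≡ a ⊎ h ≡ b → h ≢ z → ∀ x → x ∈ B ∪ ⁅ y ⁆ → x ≢ z
        → Reach G (λ u → u ∈ B ∪ ⁅ y ⁆ × u ≢ z) x h
      to-hub z h h-ab h≢z x x∈ x≢z with x∈p∪q⁻ B ⁅ y ⁆ x∈
      ... | inj₁ x∈B = reach-mono (λ (u∈ , u≢z) → p⊆p∪q ⁅ y ⁆ u∈ , u≢z)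
                         (biconnected-avoiding bc z x h (x∈B , x≢z) (one-of h-ab a∈ b∈ , h≢z))
      ... | inj₂ x∈y with x∈⁅y⁆⇒x≡y y x∈y
      ...   | refl = reach-edge (x∈ , x≢z) (one-of {P = Adj G y} h-ab ya yb)
                       (p⊆p∪q ⁅ y ⁆ (one-of h-ab a∈ b∈) , h≢z)

  edge-biconnected : ∀ {x y} → Adj G x y → Biconnected G (⁅ x ⁆ ∪ ⁅ y ⁆)
  edge-biconnected {x} {y} xy =
    biconnected-via-hubs size (adj-irrefl xy) to-x to-hub
    where
      B : Subset n
      B = ⁅ x ⁆ ∪ ⁅ y ⁆
      x∈ : x ∈ B
      x∈ = p⊆p∪q ⁅ y ⁆ (x∈⁅x⁆ x)
      y∈ : y ∈ B
      y∈ = q⊆p∪q ⁅ x ⁆ ⁅ y ⁆ (x∈⁅x⁆ y)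
      size : 2 ≤ ∣ B ∣
      size = subst (_< ∣ B ∣) (∣⁅x⁆∣≡1 x)
        (p⊂q⇒∣p∣<∣q∣ (p⊆p∪q ⁅ y ⁆ , y , y∈ , λ y∈x → adj-irrefl xy (sym (x∈⁅y⁆⇒x≡y x y∈x))))
      endpoint : ∀ {t} → t ∈ B → t ≡ x ⊎ t ≡ y
      endpoint {t} t∈ with x∈p∪q⁻ ⁅ x ⁆ ⁅ y ⁆ t∈
      ... | inj₁ t∈x = inj₁ (x∈⁅y⁆⇒x≡y x t∈x)
      ... | inj₂ t∈y = inj₂ (x∈⁅y⁆⇒x≡y y t∈y)
      to-x : ∀ t → t ∈ B → Reach G (_∈ B) t x
      to-x t t∈ with endpoint t∈
      ... | inj₁ refl = here x∈
      ... | inj₂ refl = reach-edge y∈ (adj-sym xy) x∈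
      to-hub : ∀ z h → h ≡ x ⊎ h ≡ y → h ≢ z → ∀ t → t ∈ B → t ≢ z
        → Reach G (λ u → u ∈ B × u ≢ z) t h
      to-hub z h h-xy h≢z t t∈ t≢z with endpoint t∈ | h-xy
      ... | inj₁ refl | inj₁ refl = here (x∈ , t≢z)
      ... | inj₁ refl | inj₂ refl = reach-edge (x∈ , t≢z) xy (y∈ , h≢z)
      ... | inj₂ refl | inj₁ refl = reach-edge (y∈ , t≢z) (adj-sym xy) (x∈ , h≢z)
      ... | inj₂ refl | inj₂ refl = here (y∈ , t≢z)

  adj? : ∀ u v → Dec (Adj G u v)
  adj? u v = Graph.adj G u v ≟ᵇ true

  -- Reachability is decided by growing the set of vertices known to be
  -- reachable until it is closed under P-steps.
  module Reachability (P : Fin n → Set) (P? : ∀ u → Dec (P u)) (x : Fin n) where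

    Step : Subset n → Fin n → Set
    Step R z = z ∈ R ⊎ (P z × ∃ λ y → y ∈ R × Adj G y z)

    step? : ∀ R z → Dec (Step R z)
    step? R z = (z ∈? R) ⊎-dec (P? z ×-dec any? (λ y → (y ∈? R) ×-dec adj? y z))

    grow : Subset n → Subset n
    grow R = tabulate (λ z → does (step? R z))

    ⊆-grow : ∀ R → R ⊆ grow R
    ⊆-grow R {z} z∈ = ∈-tabulate⁺ (dec-true (step? R z) (inj₁ z∈))

    Reached : Subset n → Set
    Reached R = ∀ z → z ∈ R → Reach G P x z

    grow-reached : ∀ R → Reached R → Reached (grow R)
    grow-reached R reached z z∈ with does⇒ (step? R z) (∈-tabulate⁻ z∈)
    ... | inj₁ z∈R              = reached z z∈R
    ... | inj₂ (pz , y , y∈ , a) = step (reached y y∈) a pz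

    closed-complete : ∀ R → grow R ⊆ R → x ∈ R → ∀ y → Reach G P x y → y ∈ R
    closed-complete R closed x∈ y (here _)               = x∈
    closed-complete R closed x∈ z (step {y = y} r a pz) =
      closed (∈-tabulate⁺ (dec-true (step? R z) (inj₂ (pz , y , closed-complete R closed x∈ y r , a))))

    search : ∀ k R → n < ∣ R ∣ + k → Reached R → x ∈ R → ∀ y → Dec (Reach G P x y)
    search zero    R lt _ _ _ = no-fuel R lt
    search (suc k) R lt reached x∈ y
      with any? (λ z → (z ∈? grow R) ×-dec ¬? (z ∈? R))
    ... | yes (z , z∈ , z∉) =
      search k (grow R) (⊂-fuel k lt (⊆-grow R , z , z∈ , z∉)) (grow-reached R reached) (⊆-grow R x∈) y
    ... | no  saturated with y ∈? R
    ...   | yes y∈ = yes (reached y y∈)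
    ...   | no  y∉ = no λ r → y∉ (closed-complete R closed x∈ y r)
      where
        closed : grow R ⊆ R
        closed {z} z∈ with z ∈? R
        ... | yes z∈R = z∈R
        ... | no  z∉R = ⊥-elim (saturated (z , z∈ , z∉R))

  reach? : (P : Fin n → Set) → (∀ u → Dec (P u)) → ∀ x y → Dec (Reach G P x y)
  reach? P P? x y with P? x
  ... | no ¬px = no λ r → ¬px (reach-start r)
  ... | yes px = Reachability.search P P? x (suc n) ⁅ x ⁆ (ℕ.m≤n+m (suc n) ∣ ⁅ x ⁆ ∣) start (x∈⁅x⁆ x) y
    where
      start : Reachability.Reached P P? x ⁅ x ⁆
      start z z∈ with x∈⁅y⁆⇒x≡y x z∈
      ... | refl = here px

  connectedOn? : (Q : Fin n → Set) → (∀ u → Dec (Q u)) → Dec (ConnectedOn G Q)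
  connectedOn? Q Q? = all? (λ x → all? (λ y → Q? x →-dec (Q? y →-dec reach? Q Q? x y)))

  biconnected? : ∀ B → Dec (Biconnected G B)
  biconnected? B = (2 ℕ.≤? ∣ B ∣) ×-dec connectedOn? (_∈ B) (_∈? B)
    ×-dec all? (λ z → (z ∈? B) →-dec
                        connectedOn? (λ u → u ∈ B × u ≢ z) (λ u → (u ∈? B) ×-dec ¬? (u ≟ᶠ z)))

  extend-to-block : ∀ {B} → Biconnected G B → Σ (Subset n) λ B′ → B ⊆ B′ × IsBlock G B′
  extend-to-block {B} = go (suc n) B (ℕ.m≤n+m (suc n) ∣ B ∣)
    where
      go : ∀ k B → n < ∣ B ∣ + k → Biconnected G B → Σ (Subset n) λ B′ → B ⊆ B′ × IsBlock G B′
      go zero    B lt _ = no-fuel B lt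
      go (suc k) B lt bc with anySubset? (λ B′ → (B ⊂? B′) ×-dec biconnected? B′)
      ... | yes (B′ , B⊂B′ , bc′) with go k B′ (⊂-fuel k lt B⊂B′) bc′
      ...   | B″ , B′⊆B″ , blk = B″ , (λ x∈ → B′⊆B″ (proj₁ B⊂B′ x∈)) , blk
      go (suc k) B lt bc | no maximal = B , (λ x∈ → x∈) , bc , max
        where
          max : ∀ B′ → B ⊆ B′ → Biconnected G B′ → B′ ⊆ B
          max B′ B⊆B′ bc′ {x} x∈ with x ∈? B
          ... | yes x∈B = x∈B
          ... | no  x∉B = ⊥-elim (maximal (B′ , (B⊆B′ , x , x∈ , x∉B) , bc′))

  edge-in-block : ∀ {x y} → Adj G x y → Σ (Subset n) λ B → IsBlock G B × x ∈ B × y ∈ B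
  edge-in-block {x} {y} xy with extend-to-block (edge-biconnected xy)
  ... | B , ⊆B , blk = B , blk , ⊆B (p⊆p∪q ⁅ y ⁆ (x∈⁅x⁆ x)) , ⊆B (q⊆p∪q ⁅ x ⁆ ⁅ y ⁆ (x∈⁅x⁆ y))

  open import Data.List.Membership.DecPropositional (_≟ᶠ_ {n}) using () renaming (_∈?_ to _∈ᴸ?_)

  -- a walk from x to y without repeated vertices; vs lists its vertices, y first
  data SimpleWalk (P : Fin n → Set) (x : Fin n) : Fin n → List (Fin n) → Set where
    start  : P x → SimpleWalk P x x (x ∷ [])
    extend : ∀ {y z vs} → SimpleWalk P x y vs → Adj G y z → P z → z ∉ᴸ vs → SimpleWalk P x z (z ∷ vs)

  simpleWalk-P : ∀ {P x y vs} → SimpleWalk P x y vs → ∀ {t} → t ∈ᴸ vs → P t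
  simpleWalk-P (start p)        (here refl) = p
  simpleWalk-P (extend _ _ p _) (here refl) = p
  simpleWalk-P (extend w _ _ _) (there t∈)  = simpleWalk-P w t∈

  simpleWalk-reach : ∀ {P x y vs} → SimpleWalk P x y vs → Reach G (_∈ᴸ vs) x y
  simpleWalk-reach (start _)        = here (here refl)
  simpleWalk-reach (extend w a _ _) = step (reach-mono there (simpleWalk-reach w)) a (here refl)

  simpleWalk-last : ∀ {P x y vs} → SimpleWalk P x y vs → y ∈ᴸ vs
  simpleWalk-last (start _)        = here refl
  simpleWalk-last (extend _ _ _ _) = here refl

  simpleWalk-prefix : ∀ {P x y vs z} → SimpleWalk P x y vs → z ∈ᴸ vs → Σ (List (Fin n)) (SimpleWalk P x z)
  simpleWalk-prefix (start p)          (here refl) = _ , start p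
  simpleWalk-prefix w@(extend _ _ _ _) (here refl) = _ , w
  simpleWalk-prefix (extend w _ _ _)   (there z∈)  = simpleWalk-prefix w z∈

  loop-erase : ∀ {P x y} → Reach G P x y → Σ (List (Fin n)) (SimpleWalk P x y)
  loop-erase (here p) = _ , start p
  loop-erase {y = z} (step r a pz) with loop-erase r
  ... | vs , w with z ∈ᴸ? vs
  ...   | yes z∈ = simpleWalk-prefix w z∈
  ...   | no  z∉ = _ , extend w a pz z∉

  simpleWalk-split : ∀ {P x y vs q} → SimpleWalk P x y vs → q ∈ᴸ vs →
    Σ (List (Fin n)) λ R → Σ (List (Fin n)) λ L → vs ≡ R ++ q ∷ L
      × Reach G (_∈ᴸ q ∷ L) q x × Reach G (_∈ᴸ R ++ q ∷ []) q y
      × (∀ {t} → t ∈ᴸ R → t ∉ᴸ q ∷ L)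
  simpleWalk-split (start p) (here refl) =
    [] , [] , refl , here (here refl) , here (here refl) , λ ()
  simpleWalk-split w@(extend _ _ _ _) (here refl) =
    [] , _ , refl , reach-sym (simpleWalk-reach w) , here (here refl) , λ ()
  simpleWalk-split (extend {z = z} w a _ z∉) (there q∈) with simpleWalk-split w q∈
  ... | R , L , refl , to-x , to-y , disj =
    z ∷ R , L , refl , to-x ,
    reach-trans (reach-mono there to-y) (reach-edge (there (reach-end to-y)) a (here refl)) ,
    disj′
    where
      disj′ : ∀ {t} → t ∈ᴸ z ∷ R → t ∉ᴸ _ ∷ L
      disj′ (here refl) t∈ = z∉ (∈-++⁺ʳ R t∈)
      disj′ (there t∈R)    = disj t∈R

  simpleWalk-back : ∀ {P x y vs t} → SimpleWalk P x y vs → t ∈ᴸ vs → Reach G (_∈ᴸ vs) t x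
  simpleWalk-back w t∈ with simpleWalk-split w t∈
  ... | R , L , refl , to-x , _ , _ = reach-mono (∈-++⁺ʳ R) to-x

  simpleWalk-avoiding : ∀ {P x y vs t z} → SimpleWalk P x y vs → t ∈ᴸ vs → t ≢ z →
    Reach G (λ v → v ∈ᴸ vs × v ≢ z) t x ⊎ Reach G (λ v → v ∈ᴸ vs × v ≢ z) t y
  simpleWalk-avoiding {t = t} {z} w t∈ t≢z with simpleWalk-split w t∈
  ... | R , L , refl , to-x , to-y , disj with z ∈ᴸ? (t ∷ L)
  ...   | no z∉ = inj₁ (reach-mono (λ v∈ → ∈-++⁺ʳ R v∈ , λ { refl → z∉ v∈ }) to-x)
  ...   | yes z∈ = inj₂ (reach-mono (λ v∈ → within v∈ , avoids v∈) to-y)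
    where
      within : ∀ {v} → v ∈ᴸ R ++ t ∷ [] → v ∈ᴸ R ++ t ∷ L
      within v∈ with ∈-++⁻ R v∈
      ... | inj₁ v∈R         = ∈-++⁺ˡ v∈R
      ... | inj₂ (here refl) = ∈-++⁺ʳ R (here refl)
      avoids : ∀ {v} → v ∈ᴸ R ++ t ∷ [] → v ≢ z
      avoids v∈ refl with ∈-++⁻ R v∈
      ... | inj₁ v∈R         = disj v∈R z∈
      ... | inj₂ (here refl) = t≢z refl

  -- A simple walk leaving a block B at x and returning to a neighbour of u ∈ B
  -- closes a cycle through B; by maximality all of it lies in B.
  cycle-in-block : ∀ {B u x y vs} → IsBlock G B → u ∈ B → x ∈ B → x ≢ u
    → SimpleWalk (_≢ u) x y vs → Adj G y u → y ∈ B
  cycle-in-block {B} {u} {x} {y} {vs} (bc@(s , c , _) , max) u∈ x∈ x≢u w yu =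
    max D (λ t∈ → D⁺ (inj₁ t∈)) D-bc (D⁺ (inj₂ (simpleWalk-last w)))
    where
      D : Subset n
      D = tabulate (λ t → does ((t ∈? B) ⊎-dec (t ∈ᴸ? vs)))
      D⁺ : ∀ {t} → t ∈ B ⊎ t ∈ᴸ vs → t ∈ D
      D⁺ {t} h = ∈-tabulate⁺ (dec-true ((t ∈? B) ⊎-dec (t ∈ᴸ? vs)) h)
      D⁻ : ∀ {t} → t ∈ D → t ∈ B ⊎ t ∈ᴸ vs
      D⁻ {t} h = does⇒ ((t ∈? B) ⊎-dec (t ∈ᴸ? vs)) (∈-tabulate⁻ h)
      inB : ∀ {z t} → t ∈ B × t ≢ z → t ∈ D × t ≢ z
      inB (t∈ , t≢z) = D⁺ (inj₁ t∈) , t≢z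
      inW : ∀ {z t} → t ∈ᴸ vs × t ≢ z → t ∈ D × t ≢ z
      inW (t∈ , t≢z) = D⁺ (inj₂ t∈) , t≢z
      to-u : ∀ t → t ∈ D → Reach G (_∈ D) t u
      to-u t t∈ with D⁻ t∈
      ... | inj₁ t∈B = reach-mono (λ k → D⁺ (inj₁ k)) (c t u t∈B u∈)
      ... | inj₂ t∈W = reach-trans (reach-mono (λ k → D⁺ (inj₂ k)) (simpleWalk-back w t∈W))
                                   (reach-mono (λ k → D⁺ (inj₁ k)) (c x u x∈ u∈))
      -- if z = u the walk back to x avoids z, otherwise one of its two halves does
      walk-exit : ∀ z t → t ∈ᴸ vs → t ≢ z
        → Σ (Fin n) λ e → e ∈ B × e ≢ z × Reach G (λ v → v ∈ D × v ≢ z) t e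
      walk-exit z t t∈ t≢z with u ≟ᶠ z
      ... | yes refl = x , x∈ , x≢u , reach-mono (λ k → D⁺ (inj₂ k) , simpleWalk-P w k) (simpleWalk-back w t∈)
      ... | no  u≢z with simpleWalk-avoiding w t∈ t≢z
      ...   | inj₁ to-x = x , x∈ , proj₂ (reach-end to-x) , reach-mono inW to-x
      ...   | inj₂ to-y =
        u , u∈ , u≢z , reach-trans (reach-mono inW to-y) (reach-edge (inW (reach-end to-y)) yu (inB (u∈ , u≢z)))
      to-hub : ∀ z h → h ≡ u ⊎ h ≡ x → h ≢ z → ∀ t → t ∈ D → t ≢ z
        → Reach G (λ v → v ∈ D × v ≢ z) t h
      to-hub z h h-ux h≢z t t∈ t≢z with D⁻ t∈
      ... | inj₁ t∈B = reach-mono inB (biconnected-avoiding bc z t h (t∈B , t≢z) (one-of h-ux u∈ x∈ , h≢z))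
      ... | inj₂ t∈W with walk-exit z t t∈W t≢z
      ...   | e , e∈ , e≢z , to-e =
        reach-trans to-e (reach-mono inB (biconnected-avoiding bc z e h (e∈ , e≢z) (one-of h-ux u∈ x∈ , h≢z)))
      D-bc : Biconnected G D
      D-bc = biconnected-via-hubs (ℕ.≤-trans s (p⊆q⇒∣p∣≤∣q∣ (λ t∈ → D⁺ (inj₁ t∈))))
               (λ e → x≢u (sym e)) to-u to-hub

  another-vertex : ∀ {B} → 2 ≤ ∣ B ∣ → ∀ u → Σ (Fin n) λ x → x ∈ B × x ≢ u
  another-vertex {B} size u with any? (λ x → (x ∈? B) ×-dec ¬? (x ≟ᶠ u))
  ... | yes found = found
  ... | no  none  = ⊥-elim (ℕ.<-irrefl refl
        (ℕ.≤-trans size (ℕ.≤-trans (p⊆q⇒∣p∣≤∣q∣ B⊆u) (ℕ.≤-reflexive (∣⁅x⁆∣≡1 u)))))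
    where
      B⊆u : B ⊆ ⁅ u ⁆
      B⊆u {x} x∈ with x ≟ᶠ u
      ... | yes refl = x∈⁅x⁆ u
      ... | no  x≢u  = ⊥-elim (none (x , x∈ , x≢u))

  shared-vertex-cutpoint : BlockGraph G → Connected G → ∀ {B₁ B₂ u}
    → IsBlock G B₁ → IsBlock G B₂ → B₁ ≢ B₂ → u ∈ B₁ → u ∈ B₂ → Cutpoint G u
  shared-vertex-cutpoint bg conn {B₁} {B₂} {u} blk₁ blk₂ B₁≢B₂ u₁ u₂
    with another-vertex (proj₁ (proj₁ blk₁)) u | another-vertex (proj₁ (proj₁ blk₂)) u
  ... | x , x₁ , x≢u | y , y₂ , y≢u = x , y , x≢u , y≢u , conn x y tt tt , separated
    where
      separated : ¬ Reach G (_≢ u) x y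
      separated r with loop-erase r
      ... | _ , w = B₁≢B₂ (block-≡ blk₁ blk₂ y≢u
                      (cycle-in-block blk₁ u₁ x₁ x≢u w (bg B₂ blk₂ y u y₂ u₂ y≢u)) u₁ y₂ u₂)

  module _ {B₁ B₂ v} (blk₁ : IsBlock G B₁) (blk₂ : IsBlock G B₂) (B₁≢B₂ : B₁ ≢ B₂)
           (v₁ : v ∈ B₁) (v₂ : v ∈ B₂) where

    distinct-blocks-distinct : ∀ {x y} → x ∈ B₁ → y ∈ B₂ → y ≢ v → x ≢ y
    distinct-blocks-distinct x₁ y₂ y≢v refl = B₁≢B₂ (block-≡ blk₁ blk₂ y≢v x₁ v₁ y₂ v₂)

    -- an edge xy would make B₁ ∪ {y} 2-connected, putting y in B₁
    distinct-blocks-nonadjacent : BlockGraph G → ∀ {x y} → x ∈ B₁ → x ≢ v → y ∈ B₂ → y ≢ v → ¬ Adj G x y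
    distinct-blocks-nonadjacent bg {x} {y} x₁ x≢v y₂ y≢v xy =
      B₁≢B₂ (block-≡ blk₁ blk₂ y≢v y₁ v₁ y₂ v₂)
      where
        y₁ : y ∈ B₁
        y₁ = proj₂ blk₁ _ (p⊆p∪q ⁅ y ⁆)
               (biconnected-∪-⁅⁆ (proj₁ blk₁) (λ e → x≢v (sym e)) v₁ x₁ (bg B₂ blk₂ y v y₂ v₂ y≢v) (adj-sym xy))
               (q⊆p∪q B₁ ⁅ y ⁆ (x∈⁅x⁆ y))

module _ {n : ℕ} (G : Graph n) where

  -- A set of deleted vertices is a Boolean predicate on vertices.
  Active : (Fin n → Bool) → Fin n → Subset n → Set
  Active S a B = Σ (Fin n) λ x → x ∈ B × x ≢ a × S x ≡ false

  LocallyClawFree : (Fin n → Bool) → Fin n → Set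
  LocallyClawFree S a = S a ≡ false → ∀ {B₁ B₂ B₃} → IsBlock G B₁ → IsBlock G B₂ → IsBlock G B₃
    → B₁ ≢ B₂ → B₁ ≢ B₃ → B₂ ≢ B₃ → a ∈ B₁ → a ∈ B₂ → a ∈ B₃
    → Active S a B₁ → Active S a B₂ → Active S a B₃ → ⊥

  claw-deletion⇒locallyClawFree : BlockGraph G → ∀ {S} → ClawDeletionSet G S → ∀ a → LocallyClawFree (lookup S) a
  claw-deletion⇒locallyClawFree bg {S} cds a a-kept blk₁ blk₂ blk₃ B₁≢B₂ B₁≢B₃ B₂≢B₃ a₁ a₂ a₃
    (x₁ , x₁∈ , x₁≢a , x₁-kept) (x₂ , x₂∈ , x₂≢a , x₂-kept) (x₃ , x₃∈ , x₃≢a , x₃-kept) =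
    cds (a , x₁ , x₂ , x₃ , kept a-kept , kept x₁-kept , kept x₂-kept , kept x₃-kept ,
         distinct-blocks-distinct G blk₁ blk₂ B₁≢B₂ a₁ a₂ x₁∈ x₂∈ x₂≢a ,
         distinct-blocks-distinct G blk₁ blk₃ B₁≢B₃ a₁ a₃ x₁∈ x₃∈ x₃≢a ,
         distinct-blocks-distinct G blk₂ blk₃ B₂≢B₃ a₂ a₃ x₂∈ x₃∈ x₃≢a ,
         bg _ blk₁ a x₁ a₁ x₁∈ (λ e → x₁≢a (sym e)) ,
         bg _ blk₂ a x₂ a₂ x₂∈ (λ e → x₂≢a (sym e)) ,
         bg _ blk₃ a x₃ a₃ x₃∈ (λ e → x₃≢a (sym e)) ,
         distinct-blocks-nonadjacent G blk₁ blk₂ B₁≢B₂ a₁ a₂ bg x₁∈ x₁≢a x₂∈ x₂≢a ,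
         distinct-blocks-nonadjacent G blk₁ blk₃ B₁≢B₃ a₁ a₃ bg x₁∈ x₁≢a x₃∈ x₃≢a ,
         distinct-blocks-nonadjacent G blk₂ blk₃ B₂≢B₃ a₂ a₃ bg x₂∈ x₂≢a x₃∈ x₃≢a)
    where
      kept : ∀ {x} → lookup S x ≡ false → x ∉ S
      kept x-kept x∈ = true≢false (trans (sym ([]=⇒lookup x∈)) x-kept)

  -- each leg of a claw lies in its own block through the centre, which is
  -- therefore a cutpoint
  locallyClawFree⇒claw-deletion : BlockGraph G → Connected G → ∀ {D}
    → (∀ a → Cutpoint G a → LocallyClawFree D a) → ClawDeletionSet G (tabulate D)
  locallyClawFree⇒claw-deletion bg conn {D} lcf
    (a , x , y , z , a∉ , x∉ , y∉ , z∉ , x≢y , x≢z , y≢z , ax , ay , az , ¬xy , ¬xz , ¬yz)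
    with edge-in-block G ax | edge-in-block G ay | edge-in-block G az
  ... | Bx , blk-x , a∈Bx , x∈Bx | By , blk-y , a∈By , y∈By | Bz , blk-z , a∈Bz , z∈Bz =
    lcf a (shared-vertex-cutpoint G bg conn blk-x blk-y Bx≢By a∈Bx a∈By) (kept a∉)
      blk-x blk-y blk-z Bx≢By Bx≢Bz By≢Bz a∈Bx a∈By a∈Bz
      (x , x∈Bx , leg ax , kept x∉) (y , y∈By , leg ay , kept y∉) (z , z∈Bz , leg az , kept z∉)
    where
      kept : ∀ {u} → u ∉ tabulate D → D u ≡ false
      kept {u} u∉ with D u in e
      ... | true  = ⊥-elim (u∉ (∈-tabulate⁺ e))
      ... | false = refl
      leg : ∀ {u} → Adj G a u → u ≢ a
      leg au e = adj-irrefl G au (sym e)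
      Bx≢By : Bx ≢ By
      Bx≢By refl = ¬xy (bg Bx blk-x x y x∈Bx y∈By x≢y)
      Bx≢Bz : Bx ≢ Bz
      Bx≢Bz refl = ¬xz (bg Bx blk-x x z x∈Bx z∈Bz x≢z)
      By≢Bz : By ≢ Bz
      By≢Bz refl = ¬yz (bg By blk-y y z y∈By z∈Bz y≢z)

  active? : ∀ S a B → Dec (Active S a B)
  active? S a B = any? (λ x → (x ∈? B) ×-dec (¬? (x ≟ᶠ a) ×-dec (S x ≟ᵇ false)))

  inactive⇒deleted : ∀ {S a B} → ¬ Active S a B → ∀ {u} → u ∈ B → u ≢ a → S u ≡ true
  inactive⇒deleted {S} ¬act {u} u∈ u≢a with S u in su
  ... | true  = refl
  ... | false = ⊥-elim (¬act (u , u∈ , u≢a , su))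

  two-candidates⇒locallyClawFree : ∀ {S a} {Q R : Subset n → Set}
    → (∀ {B B′} → Q B → Q B′ → B ≡ B′) → (∀ {B B′} → R B → R B′ → B ≡ B′)
    → (∀ {B} → IsBlock G B → a ∈ B → Active S a B → Q B ⊎ R B) → LocallyClawFree S a
  two-candidates⇒locallyClawFree {Q = Q} {R} Q-unique R-unique candidate
    _ blk₁ blk₂ blk₃ ≢₁₂ ≢₁₃ ≢₂₃ a₁ a₂ a₃ act₁ act₂ act₃ =
      pigeonhole (candidate blk₁ a₁ act₁) (candidate blk₂ a₂ act₂) (candidate blk₃ a₃ act₃) ≢₁₂ ≢₁₃ ≢₂₃
    where
      pigeonhole : ∀ {B₁ B₂ B₃} → Q B₁ ⊎ R B₁ → Q B₂ ⊎ R B₂ → Q B₃ ⊎ R B₃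
        → B₁ ≢ B₂ → B₁ ≢ B₃ → B₂ ≢ B₃ → ⊥
      pigeonhole (inj₁ q₁) (inj₁ q₂) _         ≢₁₂ _   _   = ≢₁₂ (Q-unique q₁ q₂)
      pigeonhole (inj₁ q₁) (inj₂ _)  (inj₁ q₃) _   ≢₁₃ _   = ≢₁₃ (Q-unique q₁ q₃)
      pigeonhole (inj₁ _)  (inj₂ r₂) (inj₂ r₃) _   _   ≢₂₃ = ≢₂₃ (R-unique r₂ r₃)
      pigeonhole (inj₂ r₁) (inj₂ r₂) _         ≢₁₂ _   _   = ≢₁₂ (R-unique r₁ r₂)
      pigeonhole (inj₂ r₁) (inj₁ _)  (inj₂ r₃) _   ≢₁₃ _   = ≢₁₃ (R-unique r₁ r₃)
      pigeonhole (inj₂ _)  (inj₁ q₂) (inj₁ q₃) _   _   ≢₂₃ = ≢₂₃ (Q-unique q₂ q₃)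

module _ {n : ℕ} where

  cutsBs≡ : ∀ (bs : List (BNode n)) → cutsBs bs ≡ concatMap cutsB bs
  cutsBs≡ []       = refl
  cutsBs≡ (b ∷ bs) = cong (cutsB b ++_) (cutsBs≡ bs)

  blocksBs≡ : ∀ (bs : List (BNode n)) → blocksBs bs ≡ concatMap blocksB bs
  blocksBs≡ []       = refl
  blocksBs≡ (b ∷ bs) = cong (blocksB b ++_) (blocksBs≡ bs)

  edgesBs≡ : ∀ (bs : List (BNode n)) → edgesBs bs ≡ concatMap edgesB bs
  edgesBs≡ []       = refl
  edgesBs≡ (b ∷ bs) = cong (edgesB b ++_) (edgesBs≡ bs)

  cutsCs≡ : ∀ (cs : List (CNode n)) → cutsCs cs ≡ concatMap cutsC cs
  cutsCs≡ []       = refl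
  cutsCs≡ (c ∷ cs) = cong (cutsC c ++_) (cutsCs≡ cs)

  blocksCs≡ : ∀ (cs : List (CNode n)) → blocksCs cs ≡ concatMap blocksC cs
  blocksCs≡ []       = refl
  blocksCs≡ (c ∷ cs) = cong (blocksC c ++_) (blocksCs≡ cs)

  edgesCs≡ : ∀ (cs : List (CNode n)) → edgesCs cs ≡ concatMap edgesC cs
  edgesCs≡ []       = refl
  edgesCs≡ (c ∷ cs) = cong (edgesC c ++_) (edgesCs≡ cs)

  ∈-cutsBs : ∀ {b bs u} → b ∈ᴸ bs → u ∈ᴸ cutsB b → u ∈ᴸ cutsBs {n} bs
  ∈-cutsBs {bs = bs} b∈ u∈ = subst (_ ∈ᴸ_) (sym (cutsBs≡ bs)) (∈-concatMap b∈ u∈)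

  ∈-blocksBs : ∀ {b bs B} → b ∈ᴸ bs → B ∈ᴸ blocksB b → B ∈ᴸ blocksBs {n} bs
  ∈-blocksBs {bs = bs} b∈ B∈ = subst (_ ∈ᴸ_) (sym (blocksBs≡ bs)) (∈-concatMap b∈ B∈)

  ∈-edgesBs : ∀ {b bs e} → b ∈ᴸ bs → e ∈ᴸ edgesB b → e ∈ᴸ edgesBs {n} bs
  ∈-edgesBs {bs = bs} b∈ e∈ = subst (_ ∈ᴸ_) (sym (edgesBs≡ bs)) (∈-concatMap b∈ e∈)

  ∈-cutsBs⁻ : ∀ bs {u} → u ∈ᴸ cutsBs {n} bs → ∃ λ b → b ∈ᴸ bs × u ∈ᴸ cutsB b
  ∈-cutsBs⁻ bs u∈ = ∈-concatMap⁻ bs (subst (_ ∈ᴸ_) (cutsBs≡ bs) u∈)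

  ∈-edgesBs⁻ : ∀ bs {e} → e ∈ᴸ edgesBs {n} bs → ∃ λ b → b ∈ᴸ bs × e ∈ᴸ edgesB b
  ∈-edgesBs⁻ bs e∈ = ∈-concatMap⁻ bs (subst (_ ∈ᴸ_) (edgesBs≡ bs) e∈)

  ∈-cutsCs : ∀ {c cs u} → c ∈ᴸ cs → u ∈ᴸ cutsC c → u ∈ᴸ cutsCs {n} cs
  ∈-cutsCs {cs = cs} c∈ u∈ = subst (_ ∈ᴸ_) (sym (cutsCs≡ cs)) (∈-concatMap c∈ u∈)

  ∈-blocksCs : ∀ {c cs B} → c ∈ᴸ cs → B ∈ᴸ blocksC c → B ∈ᴸ blocksCs {n} cs
  ∈-blocksCs {cs = cs} c∈ B∈ = subst (_ ∈ᴸ_) (sym (blocksCs≡ cs)) (∈-concatMap c∈ B∈)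

  ∈-edgesCs : ∀ {c cs e} → c ∈ᴸ cs → e ∈ᴸ edgesC c → e ∈ᴸ edgesCs {n} cs
  ∈-edgesCs {cs = cs} c∈ e∈ = subst (_ ∈ᴸ_) (sym (edgesCs≡ cs)) (∈-concatMap c∈ e∈)

  ∈-cutsCs⁻ : ∀ cs {u} → u ∈ᴸ cutsCs {n} cs → ∃ λ c → c ∈ᴸ cs × u ∈ᴸ cutsC c
  ∈-cutsCs⁻ cs u∈ = ∈-concatMap⁻ cs (subst (_ ∈ᴸ_) (cutsCs≡ cs) u∈)

  ∈-edgesCs⁻ : ∀ cs {e} → e ∈ᴸ edgesCs {n} cs → ∃ λ c → c ∈ᴸ cs × e ∈ᴸ edgesC c
  ∈-edgesCs⁻ cs e∈ = ∈-concatMap⁻ cs (subst (_ ∈ᴸ_) (edgesCs≡ cs) e∈)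

  bset∈blocksB : ∀ (b : BNode n) → bset b ∈ᴸ blocksB b
  bset∈blocksB (bnode _ _) = here refl

  label∈cutsC : ∀ (c : CNode n) → label c ∈ᴸ cutsC c
  label∈cutsC (cnode _ _) = here refl

  mutual
    edgeC-nodes : ∀ (c : CNode n) {u B} → (u , B) ∈ᴸ edgesC c → u ∈ᴸ cutsC c × B ∈ᴸ blocksC c
    edgeC-nodes (cnode v bs) e∈ with ∈-++⁻ (map (λ b → (v , bset b)) bs) e∈
    ... | inj₁ e∈map with ∈-map⁻ _ e∈map
    ...   | b , b∈ , refl = here refl , ∈-blocksBs b∈ (bset∈blocksB b)
    edgeC-nodes (cnode v bs) e∈ | inj₂ e∈bs with edgeBs-nodes bs e∈bs
    ...   | u∈ , B∈ = there u∈ , B∈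

    edgeBs-nodes : ∀ (bs : List (BNode n)) {u B} → (u , B) ∈ᴸ edgesBs bs → u ∈ᴸ cutsBs bs × B ∈ᴸ blocksBs bs
    edgeBs-nodes (b ∷ bs) e∈ with ∈-++⁻ (edgesB b) e∈
    ... | inj₁ e∈b with edgeB-nodes b e∈b
    ...   | u∈ , B∈ = ∈-++⁺ˡ u∈ , ∈-++⁺ˡ B∈
    edgeBs-nodes (b ∷ bs) e∈ | inj₂ e∈bs with edgeBs-nodes bs e∈bs
    ...   | u∈ , B∈ = ∈-++⁺ʳ (cutsB b) u∈ , ∈-++⁺ʳ (blocksB b) B∈

    edgeB-nodes : ∀ (b : BNode n) {u B} → (u , B) ∈ᴸ edgesB b → u ∈ᴸ cutsB b × B ∈ᴸ blocksB b
    edgeB-nodes (bnode B cs) e∈ with ∈-++⁻ (map (λ c → (label c , B)) cs) e∈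
    ... | inj₁ e∈map with ∈-map⁻ _ e∈map
    ...   | c , c∈ , refl = ∈-cutsCs c∈ (label∈cutsC c) , here refl
    edgeB-nodes (bnode B cs) e∈ | inj₂ e∈cs with edgeCs-nodes cs e∈cs
    ...   | u∈ , B∈ = u∈ , there B∈

    edgeCs-nodes : ∀ (cs : List (CNode n)) {u B} → (u , B) ∈ᴸ edgesCs cs → u ∈ᴸ cutsCs cs × B ∈ᴸ blocksCs cs
    edgeCs-nodes (c ∷ cs) e∈ with ∈-++⁻ (edgesC c) e∈
    ... | inj₁ e∈c with edgeC-nodes c e∈c
    ...   | u∈ , B∈ = ∈-++⁺ˡ u∈ , ∈-++⁺ˡ B∈
    edgeCs-nodes (c ∷ cs) e∈ | inj₂ e∈cs with edgeCs-nodes cs e∈cs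
    ...   | u∈ , B∈ = ∈-++⁺ʳ (cutsC c) u∈ , ∈-++⁺ʳ (blocksC c) B∈

module _ {n : ℕ} (G : Graph n) where

  Incident : Fin n → Subset n → Set
  Incident u B = Cutpoint G u × IsBlock G B × u ∈ B

  -- the subtree T_c of the block-cutpoint tree, below the block `parent`
  -- (nothing at the root)
  record CutSubtree (c : CNode n) (parent : Maybe (Subset n)) : Set where
    field
      cuts-unique     : Unique (cutsC c)
      blocks-unique   : Unique (blocksC c)
      cut-sound       : ∀ {u} → u ∈ᴸ cutsC c → Cutpoint G u
      block-sound     : ∀ {B} → B ∈ᴸ blocksC c → IsBlock G B
      edge-sound      : ∀ {u B} → (u , B) ∈ᴸ edgesC c → Incident u B
      block-complete  : ∀ {u B} → B ∈ᴸ blocksC c → Incident u B → (u , B) ∈ᴸ edgesC c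
      cut-complete    : ∀ {u B} → u ∈ᴸ cutsC c → Incident u B
                        → (parent ≡ just B × u ≡ label c) ⊎ (u , B) ∈ᴸ edgesC c
      parent-outside  : ∀ {P} → parent ≡ just P → P ∉ᴸ blocksC c
      parent-incident : ∀ {P} → parent ≡ just P → IsBlock G P × label c ∈ P

  record BlockSubtree (b : BNode n) (p : Fin n) : Set where
    field
      cuts-unique     : Unique (cutsB b)
      blocks-unique   : Unique (blocksB b)
      cut-sound       : ∀ {u} → u ∈ᴸ cutsB b → Cutpoint G u
      block-sound     : ∀ {B} → B ∈ᴸ blocksB b → IsBlock G B
      edge-sound      : ∀ {u B} → (u , B) ∈ᴸ edgesB b → Incident u B
      block-complete  : ∀ {u B} → B ∈ᴸ blocksB b → Incident u B
                        → (u ≡ p × B ≡ bset b) ⊎ (u , B) ∈ᴸ edgesB b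
      cut-complete    : ∀ {u B} → u ∈ᴸ cutsB b → Incident u B → (u , B) ∈ᴸ edgesB b
      parent-outside  : p ∉ᴸ cutsB b
      parent-incident : Cutpoint G p × p ∈ bset b

  root-subtree : ∀ {r T} → IsBlockCutpointTree G r T → CutSubtree T nothing
  root-subtree (_ , cuts-unique , cuts , blocks-unique , blocks , edges) = record
    { cuts-unique     = cuts-unique
    ; blocks-unique   = blocks-unique
    ; cut-sound       = Equivalence.to (cuts _)
    ; block-sound     = Equivalence.to (blocks _)
    ; edge-sound      = Equivalence.to (edges _ _)
    ; block-complete  = λ _ inc → Equivalence.from (edges _ _) inc
    ; cut-complete    = λ _ inc → inj₂ (Equivalence.from (edges _ _) inc)
    ; parent-outside  = λ ()
    ; parent-incident = λ ()
    }

  module _ {v bs parent} (I : CutSubtree (cnode v bs) parent) {b} (b∈ : b ∈ᴸ bs) where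

    private
      open CutSubtree I
      down : BNode n → Fin n × Subset n
      down b = (v , bset b)
      U-cuts : Unique (concatMap cutsB bs)
      U-cuts with cuts-unique
      ... | _ ∷ u = subst Unique (cutsBs≡ bs) u
      U-blocks : Unique (concatMap blocksB bs)
      U-blocks = subst Unique (blocksBs≡ bs) blocks-unique
      v∉ : v ∉ᴸ cutsBs bs
      v∉ = Unique[x∷xs]⇒x∉xs cuts-unique

    child-block-complete : ∀ {u B} → B ∈ᴸ blocksB b → Incident u B → (u ≡ v × B ≡ bset b) ⊎ (u , B) ∈ᴸ edgesB b
    child-block-complete B∈ inc with ∈-++⁻ (map down bs) (block-complete (∈-blocksBs b∈ B∈) inc)
    ... | inj₁ e∈ with ∈-map⁻ down e∈
    ...   | b′ , b′∈ , refl with concatMap-owner U-blocks b∈ b′∈ B∈ (bset∈blocksB b′)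
    ...     | refl = inj₁ (refl , refl)
    child-block-complete B∈ inc | inj₂ e∈ with ∈-edgesBs⁻ bs e∈
    ...   | b′ , b′∈ , e∈b′ with concatMap-owner U-blocks b∈ b′∈ B∈ (proj₂ (edgeB-nodes b′ e∈b′))
    ...     | refl = inj₂ e∈b′

    child-cut-complete : ∀ {u B} → u ∈ᴸ cutsB b → Incident u B → (u , B) ∈ᴸ edgesB b
    child-cut-complete u∈ inc with cut-complete (there (∈-cutsBs b∈ u∈)) inc
    ... | inj₁ (_ , refl) = ⊥-elim (v∉ (∈-cutsBs b∈ u∈))
    ... | inj₂ e∈ with ∈-++⁻ (map down bs) e∈
    ...   | inj₁ e∈map with ∈-map⁻ down e∈map
    ...     | _ , _ , refl = ⊥-elim (v∉ (∈-cutsBs b∈ u∈))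
    child-cut-complete u∈ inc | inj₂ e∈ | inj₂ e∈bs with ∈-edgesBs⁻ bs e∈bs
    ...     | b′ , b′∈ , e∈b′ with concatMap-owner U-cuts b∈ b′∈ u∈ (proj₁ (edgeB-nodes b′ e∈b′))
    ...       | refl = e∈b′

    child-blockSubtree : BlockSubtree b v
    child-blockSubtree = record
      { cuts-unique     = Unique-concatMap⁻ U-cuts b∈
      ; blocks-unique   = Unique-concatMap⁻ U-blocks b∈
      ; cut-sound       = λ u∈ → cut-sound (there (∈-cutsBs b∈ u∈))
      ; block-sound     = λ B∈ → block-sound (∈-blocksBs b∈ B∈)
      ; edge-sound      = λ e∈ → edge-sound (∈-++⁺ʳ (map down bs) (∈-edgesBs b∈ e∈))
      ; block-complete  = child-block-complete
      ; cut-complete    = child-cut-complete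
      ; parent-outside  = λ v∈ → v∉ (∈-cutsBs b∈ v∈)
      ; parent-incident = cut-sound (here refl) , proj₂ (proj₂ (edge-sound (∈-++⁺ˡ (∈-map⁺ down b∈))))
      }

  module _ {B cs p} (I : BlockSubtree (bnode B cs) p) {c} (c∈ : c ∈ᴸ cs) where

    private
      open BlockSubtree I
      up : CNode n → Fin n × Subset n
      up c = (label c , B)
      U-cuts : Unique (concatMap cutsC cs)
      U-cuts = subst Unique (cutsCs≡ cs) cuts-unique
      U-blocks : Unique (concatMap blocksC cs)
      U-blocks with blocks-unique
      ... | _ ∷ u = subst Unique (blocksCs≡ cs) u
      B∉ : B ∉ᴸ blocksCs cs
      B∉ = Unique[x∷xs]⇒x∉xs blocks-unique

    child-block-complete′ : ∀ {u B′} → B′ ∈ᴸ blocksC c → Incident u B′ → (u , B′) ∈ᴸ edgesC c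
    child-block-complete′ B∈ inc with block-complete (there (∈-blocksCs c∈ B∈)) inc
    ... | inj₁ (_ , refl) = ⊥-elim (B∉ (∈-blocksCs c∈ B∈))
    ... | inj₂ e∈ with ∈-++⁻ (map up cs) e∈
    ...   | inj₁ e∈map with ∈-map⁻ up e∈map
    ...     | _ , _ , refl = ⊥-elim (B∉ (∈-blocksCs c∈ B∈))
    child-block-complete′ B∈ inc | inj₂ e∈ | inj₂ e∈cs with ∈-edgesCs⁻ cs e∈cs
    ...     | c′ , c′∈ , e∈c′ with concatMap-owner U-blocks c∈ c′∈ B∈ (proj₂ (edgeC-nodes c′ e∈c′))
    ...       | refl = e∈c′

    child-cut-complete′ : ∀ {u B′} → u ∈ᴸ cutsC c → Incident u B′
      → (just B ≡ just B′ × u ≡ label c) ⊎ (u , B′) ∈ᴸ edgesC c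
    child-cut-complete′ u∈ inc with ∈-++⁻ (map up cs) (cut-complete (∈-cutsCs c∈ u∈) inc)
    ... | inj₁ e∈ with ∈-map⁻ up e∈
    ...   | c′ , c′∈ , refl with concatMap-owner U-cuts c∈ c′∈ u∈ (label∈cutsC c′)
    ...     | refl = inj₁ (refl , refl)
    child-cut-complete′ u∈ inc | inj₂ e∈ with ∈-edgesCs⁻ cs e∈
    ...   | c′ , c′∈ , e∈c′ with concatMap-owner U-cuts c∈ c′∈ u∈ (proj₁ (edgeC-nodes c′ e∈c′))
    ...     | refl = inj₂ e∈c′

    child-cutSubtree : CutSubtree c (just B)
    child-cutSubtree = record
      { cuts-unique     = Unique-concatMap⁻ U-cuts c∈
      ; blocks-unique   = Unique-concatMap⁻ U-blocks c∈
      ; cut-sound       = λ u∈ → cut-sound (∈-cutsCs c∈ u∈)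
      ; block-sound     = λ B∈ → block-sound (there (∈-blocksCs c∈ B∈))
      ; edge-sound      = λ e∈ → edge-sound (∈-++⁺ʳ (map up cs) (∈-edgesCs c∈ e∈))
      ; block-complete  = child-block-complete′
      ; cut-complete    = child-cut-complete′
      ; parent-outside  = λ { refl B∈ → B∉ (∈-blocksCs c∈ B∈) }
      ; parent-incident = λ { refl → block-sound (here refl) , proj₂ (proj₂ (edge-sound (∈-++⁺ˡ (∈-map⁺ up c∈)))) }
      }

  module _ {v bs parent} (I : CutSubtree (cnode v bs) parent) where
    open CutSubtree I

    blocks-at-cutpoint : ∀ {B} → IsBlock G B → v ∈ B → parent ≡ just B ⊎ B ∈ᴸ map bset bs
    blocks-at-cutpoint blk v∈ with cut-complete (here refl) (cut-sound (here refl) , blk , v∈)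
    ... | inj₁ (e , _) = inj₁ e
    ... | inj₂ e∈ with ∈-++⁻ (map (λ b → (v , bset b)) bs) e∈
    ...   | inj₁ e∈map with ∈-map⁻ _ e∈map
    ...     | b , b∈ , refl = inj₂ (∈-map⁺ bset b∈)
    blocks-at-cutpoint blk v∈ | inj₂ e∈ | inj₂ e∈bs =
      ⊥-elim (Unique[x∷xs]⇒x∉xs cuts-unique (proj₁ (edgeBs-nodes bs e∈bs)))

    child-block : ∀ {b} → b ∈ᴸ bs → IsBlock G (bset b) × v ∈ bset b
    child-block {b} b∈ = BlockSubtree.block-sound J (bset∈blocksB b) , proj₂ (BlockSubtree.parent-incident J)
      where
        J : BlockSubtree b v
        J = child-blockSubtree I b∈

    child-blocks-unique : Unique (map bset bs)
    child-blocks-unique = Unique-map-representative bset∈blocksB (subst Unique (blocksBs≡ bs) blocks-unique)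

    parent∉child-blocks : ∀ {P} → parent ≡ just P → P ∉ᴸ map bset bs
    parent∉child-blocks e P∈ with ∈-map⁻ bset P∈
    ... | b , b∈ , refl = parent-outside e (∈-blocksBs b∈ (bset∈blocksB b))

  module _ {B cs p} (I : BlockSubtree (bnode B cs) p) where
    open BlockSubtree I

    cutpoints-in-block : ∀ {u} → Cutpoint G u → u ∈ B → u ≡ p ⊎ u ∈ᴸ map label cs
    cutpoints-in-block cp u∈ with block-complete (here refl) (cp , block-sound (here refl) , u∈)
    ... | inj₁ (e , _) = inj₁ e
    ... | inj₂ e∈ with ∈-++⁻ (map (λ c → (label c , B)) cs) e∈
    ...   | inj₁ e∈map with ∈-map⁻ _ e∈map
    ...     | c , c∈ , refl = inj₂ (∈-map⁺ label c∈)
    cutpoints-in-block cp u∈ | inj₂ e∈ | inj₂ e∈cs =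
      ⊥-elim (Unique[x∷xs]⇒x∉xs blocks-unique (proj₂ (edgeCs-nodes cs e∈cs)))

    child-cut : ∀ {c} → c ∈ᴸ cs → Cutpoint G (label c) × label c ∈ B
    child-cut {c} c∈ = CutSubtree.cut-sound J (label∈cutsC c) , proj₂ (CutSubtree.parent-incident J refl)
      where
        J : CutSubtree c (just B)
        J = child-cutSubtree I c∈

    child-cuts-unique : Unique (map label cs)
    child-cuts-unique = Unique-map-representative label∈cutsC (subst Unique (cutsCs≡ cs) cuts-unique)

    parent∉child-cuts : p ∉ᴸ map label cs
    parent∉child-cuts p∈ with ∈-map⁻ label p∈
    ... | c , c∈ , refl = parent-outside (∈-cutsCs c∈ (label∈cutsC c))

module _ {n : ℕ} (w : Fin n → ℕ) where

  W : (Fin n → Bool) → ℕ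
  W f = sum (map (λ u → if f u then w u else 0) (allFin n))

  W-cong : ∀ {f g} → (∀ u → f u ≡ g u) → W f ≡ W g
  W-cong f≡g = sum-map-cong (allFin n) (λ u → cong (λ b → if b then w u else 0) (f≡g u))

  w≤W : ∀ {f v} → f v ≡ true → w v ≤ W f
  w≤W {f} {v} fv = ℕ.≤-trans (ℕ.≤-reflexive (cong (λ b → if b then w v else 0) (sym fv)))
                             (term-≤-sum (λ u → if f u then w u else 0) (∈-allFin v))

  W-∅ : W (λ _ → false) ≡ 0
  W-∅ = sum-map-zero _ (allFin n) (λ _ → refl)

  W-∪ : ∀ f g → W (λ u → f u ∨ g u) ≤ W f + W g
  W-∪ f g = ℕ.≤-trans (sum-map-mono (allFin n) pointwise) (ℕ.≤-reflexive (sum-map-+ _ _ (allFin n)))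
    where
      pointwise : ∀ u → (if f u ∨ g u then w u else 0) ≤ (if f u then w u else 0) + (if g u then w u else 0)
      pointwise u with f u | g u
      ... | true  | _     = ℕ.m≤m+n (w u) _
      ... | false | true  = ℕ.≤-refl
      ... | false | false = z≤n

  W-singleton : ∀ {f v} → (∀ u → f u ≡ true → u ≡ v) → W f ≤ w v
  W-singleton {f} {v} only-v = ℕ.≤-trans (ℕ.≤-reflexive (sum-map-cong (allFin n) at-v))
    (sum-at-most-one f (w v) (allFin n) (allFin⁺ n) λ _ _ x≢y fx fy → x≢y (trans (only-v _ fx) (sym (only-v _ fy))))
    where
      at-v : ∀ u → (if f u then w u else 0) ≡ (if f u then w v else 0)
      at-v u with f u in fu
      ... | true  = cong w (only-v u fu)
      ... | false = refl

  WSum⇒W : ∀ {P : Fin n → Set} {f : Fin n → Bool} {xs k} → WSum w P xs k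
    → (∀ u → f u ≡ true → P u) → (∀ u → P u → f u ≡ true) → k ≡ sum (map (λ u → if f u then w u else 0) xs)
  WSum⇒W nil _ _ = refl
  WSum⇒W (keep {x = x} px ws) f⇒P P⇒f rewrite P⇒f x px = cong (w x +_) (WSum⇒W ws f⇒P P⇒f)
  WSum⇒W {f = f} (skip {x = x} ¬px ws) f⇒P P⇒f with f x in fx
  ... | true  = ⊥-elim (¬px (f⇒P x fx))
  ... | false = WSum⇒W ws f⇒P P⇒f

data Regime : Set where
  ₁ ₂ ₃ : Regime

f⟨_⟩ : Regime → Triple → ℕ
f⟨ ₁ ⟩ = f₁
f⟨ ₂ ⟩ = f₂
f⟨ ₃ ⟩ = f₃

module _ {n : ℕ} where

  Deletion : Set
  Deletion = Fin n → Bool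

  _⊆ᵈ_ : Deletion → Deletion → Set
  D ⊆ᵈ D′ = ∀ {u} → D u ≡ true → D′ u ≡ true

  _∪ᵈ_ : Deletion → Deletion → Deletion
  (D ∪ᵈ D′) u = D u ∨ D′ u

  ⊆-∪ˡ : ∀ D D′ → D ⊆ᵈ (D ∪ᵈ D′)
  ⊆-∪ˡ D D′ e rewrite e = refl

  ⊆-∪ʳ : ∀ D D′ → D′ ⊆ᵈ (D ∪ᵈ D′)
  ⊆-∪ʳ D D′ {u} e with D u
  ... | true  = refl
  ... | false = e

  ∪-⊆ˡ : ∀ D D′ {S} → (D ∪ᵈ D′) ⊆ᵈ S → D ⊆ᵈ S
  ∪-⊆ˡ D D′ sub e = sub (⊆-∪ˡ D D′ e)

  ∪-⊆ʳ : ∀ D D′ {S} → (D ∪ᵈ D′) ⊆ᵈ S → D′ ⊆ᵈ S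
  ∪-⊆ʳ D D′ sub e = sub (⊆-∪ʳ D D′ e)

  module _ {X : Set} {P : X → Set} (set : ∀ {x} → P x → Deletion) where

    ⋃ : ∀ {xs} → All P xs → Deletion
    ⋃ []       _ = false
    ⋃ (p ∷ ps) u = set p u ∨ ⋃ ps u

    W-⋃ : ∀ (w : Fin n → ℕ) (cost : X → ℕ) → (∀ {x} (p : P x) → W w (set p) ≤ cost x)
      → ∀ {xs} (ps : All P xs) → W w (⋃ ps) ≤ sum (map cost xs)
    W-⋃ w cost bound []       = ℕ.≤-reflexive (W-∅ w)
    W-⋃ w cost bound (p ∷ ps) = ℕ.≤-trans (W-∪ w (set p) (⋃ ps)) (ℕ.+-mono-≤ (bound p) (W-⋃ w cost bound ps))

    ⊆-⋃ : ∀ {xs} (ps : All P xs) {x} (x∈ : x ∈ᴸ xs) → set (All.lookup ps x∈) ⊆ᵈ ⋃ ps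
    ⊆-⋃ (p ∷ ps) (here refl) = ⊆-∪ˡ (set p) (⋃ ps)
    ⊆-⋃ (p ∷ ps) (there x∈)  = λ e → ⊆-∪ʳ (set p) (⋃ ps) (⊆-⋃ ps x∈ e)

-- Of the block-cutpoint tree T only the fact that its cutpoint nodes are the
-- cutpoints of G is assumed here; the rest enters through CutSubtree.
module Programme {n : ℕ} (G : Graph n) (w : Fin n → ℕ) (s : Subset n → ℕ) (T : CNode n)
  (cutpoints-of-T : ∀ u → (u ∈ᴸ cutsC T) ⇔ Cutpoint G u) (s-spec : IsSFun G w s) where

  open import Data.List.Membership.DecPropositional (_≟ᶠ_ {n}) using () renaming (_∈?_ to _∈ᴸ?_)

  FC : CNode n → Triple
  FC = fC w s
  FB : BNode n → Triple
  FB = fB w s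

  map-fBs : ∀ {X : Set} (h : Triple → X) bs → map h (fBs w s bs) ≡ map (λ b → h (FB b)) bs
  map-fBs h []       = refl
  map-fBs h (b ∷ bs) = cong (h (FB b) ∷_) (map-fBs h bs)

  map-fCs : ∀ {X : Set} (h : Triple → X) cs → map h (fCs w s cs) ≡ map (λ c → h (FC c)) cs
  map-fCs h []       = refl
  map-fCs h (c ∷ cs) = cong (h (FC c) ∷_) (map-fCs h cs)

  f₁f₃ : Triple → ℕ × ℕ
  f₁f₃ t = (f₁ t , f₃ t)

  f₁f₂ : Triple → ℕ × ℕ
  f₁f₂ t = (f₁ t , f₂ t)

  -- a cutpoint node charges f₁ or f₃ to a child block, a block node f₁ or f₂ to a child cutpoint
  module ChildBlocks = Selection (λ b → f₁ (FB b)) (λ b → f₃ (FB b))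
  module ChildCuts = Selection (λ c → f₁ (FC c)) (λ c → f₂ (FC c))

  cutpoint? : ∀ u → Dec (Cutpoint G u)
  cutpoint? u = map′ (Equivalence.to (cutpoints-of-T u)) (Equivalence.from (cutpoints-of-T u)) (u ∈ᴸ? cutsC T)

  isCut : Fin n → Bool
  isCut u = does (cutpoint? u)

  isCut⇒ : ∀ {u} → isCut u ≡ true → Cutpoint G u
  isCut⇒ {u} = does⇒ (cutpoint? u)

  isCut⇐ : ∀ {u} → Cutpoint G u → isCut u ≡ true
  isCut⇐ {u} = dec-true (cutpoint? u)

  inner : Subset n → Fin n → Bool
  inner B u = does (u ∈? B) ∧ not (isCut u)

  inner⇒ : ∀ {B u} → inner B u ≡ true → u ∈ B × ¬ Cutpoint G u
  inner⇒ {B} {u} e with u ∈? B | isCut u in cut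
  ... | yes u∈ | false = u∈ , λ cp → true≢false (trans (sym (isCut⇐ cp)) cut)

  inner⇐ : ∀ {B u} → u ∈ B → ¬ Cutpoint G u → inner B u ≡ true
  inner⇐ {B} {u} u∈ ¬cp with u ∈? B | isCut u in cut
  ... | yes _  | false = refl
  ... | yes _  | true  = ⊥-elim (¬cp (isCut⇒ cut))
  ... | no u∉  | _     = ⊥-elim (u∉ u∈)

  s≡W-inner : ∀ {B} → IsBlock G B → s B ≡ W w (inner B)
  s≡W-inner {B} blk = WSum⇒W w (s-spec B blk) (λ u e → inner⇒ e) (λ u (u∈ , ¬cp) → inner⇐ u∈ ¬cp)

  is : Fin n → Fin n → Bool
  is v u = does (u ≟ᶠ v)

  f₁-block : ∀ B cs → f₁ (FB (bnode B cs)) ≡ s B + sum (map f₁ (fCs w s cs))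
  f₁-block B []      = sym (ℕ.+-identityʳ (s B))
  f₁-block B (_ ∷ _) = refl

  f₃-block : ∀ B cs → f₃ (FB (bnode B cs)) ≡ sum (map (λ t → f₁ t ⊓ f₃ t) (fCs w s cs))
  f₃-block B []      = refl
  f₃-block B (_ ∷ _) = refl

  f₂≤f₃-block : ∀ B cs → f₂ (FB (bnode B cs)) ≤ f₃ (FB (bnode B cs))
  f₂≤f₃-block B []      = ℕ.≤-refl
  f₂≤f₃-block B (_ ∷ _) = ℕ.m⊓n≤m _ _

  module LowerBound (S : Fin n → Bool) (S-lcf : ∀ a → LocallyClawFree G S a) where

    -- the part of the weight of S owned by a subtree: a cutpoint node owns its
    -- cutpoint, a block node the inner vertices of its block
    mutual
      costC : CNode n → ℕ
      costC (cnode v bs) = W w (λ u → is v u ∧ S u) + costBs bs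

      costBs : List (BNode n) → ℕ
      costBs []       = 0
      costBs (b ∷ bs) = costB b + costBs bs

      costB : BNode n → ℕ
      costB (bnode B cs) = W w (λ u → inner B u ∧ S u) + costCs cs

      costCs : List (CNode n) → ℕ
      costCs []       = 0
      costCs (c ∷ cs) = costC c + costCs cs

    costBs≡ : ∀ bs → costBs bs ≡ sum (map costB bs)
    costBs≡ []       = refl
    costBs≡ (b ∷ bs) = cong (costB b +_) (costBs≡ bs)

    costCs≡ : ∀ cs → costCs cs ≡ sum (map costC cs)
    costCs≡ []       = refl
    costCs≡ (c ∷ cs) = cong (costC c +_) (costCs≡ cs)

    record CutBound (c : CNode n) (parent : Maybe (Subset n)) : Set where
      field
        bound₁ : S (label c) ≡ true → f₁ (FC c) ≤ costC c
        bound₂ : S (label c) ≡ false → f₂ (FC c) ≤ costC c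
        bound₃ : S (label c) ≡ false → ∀ {P} → parent ≡ just P → Active G S (label c) P → f₃ (FC c) ≤ costC c

    record BlockBound (b : BNode n) (p : Fin n) : Set where
      field
        bound₁ : (∀ {u} → u ∈ bset b → u ≢ p → S u ≡ true) → f₁ (FB b) ≤ costB b
        bound₂ : f₂ (FB b) ≤ costB b
        bound₃ : S p ≡ false → f₃ (FB b) ≤ costB b

    open CutBound
    open BlockBound

    module _ {v bs parent} (I : CutSubtree G (cnode v bs) parent) (kept : S v ≡ false) where

      private
        distinct-children : ∀ {ys} → ys ⊆ᴸ bs → Unique (map bset ys)
        distinct-children τ = Unique-resp-⊇ (Sublist.map⁺ bset τ) (child-blocks-unique G I)

        child : ∀ {ys y} → ys ⊆ᴸ bs → y ∈ᴸ ys → IsBlock G (bset y) × v ∈ bset y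
        child τ y∈ = child-block G I (lookup-⊆ᴸ τ y∈)

      no-three-active-children : ∀ {ys} → ys ⊆ᴸ bs → All (λ b → Active G S v (bset b)) ys → length ys ≡ 3 → ⊥
      no-three-active-children {_ ∷ _ ∷ _ ∷ []} τ (act₁ ∷ act₂ ∷ act₃ ∷ []) refl =
        let blk₁ , v₁ = child τ (here refl)
            blk₂ , v₂ = child τ (there (here refl))
            blk₃ , v₃ = child τ (there (there (here refl)))
            ≢₁₂ , ≢₁₃ , ≢₂₃ = Unique₃⇒≢ (distinct-children τ)
        in S-lcf v kept blk₁ blk₂ blk₃ ≢₁₂ ≢₁₃ ≢₂₃ v₁ v₂ v₃ act₁ act₂ act₃

      no-two-active-children-below : ∀ {P} → parent ≡ just P → Active G S v P
        → ∀ {ys} → ys ⊆ᴸ bs → All (λ b → Active G S v (bset b)) ys → length ys ≡ 2 → ⊥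
      no-two-active-children-below {P} refl actP {_ ∷ _ ∷ []} τ (act₁ ∷ act₂ ∷ []) refl =
        let blkP , vP = CutSubtree.parent-incident I refl
            blk₁ , v₁ = child τ (here refl)
            blk₂ , v₂ = child τ (there (here refl))
            ≢₁₂ = Unique₂⇒≢ (distinct-children τ)
        in S-lcf v kept blkP blk₁ blk₂ (P≢ (lookup-⊆ᴸ τ (here refl))) (P≢ (lookup-⊆ᴸ τ (there (here refl)))) ≢₁₂
             vP v₁ v₂ actP act₁ act₂
        where
          P≢ : ∀ {b} → b ∈ᴸ bs → P ≢ bset b
          P≢ b∈ P≡ = parent∉child-blocks G I refl (subst (_∈ᴸ map bset bs) (sym P≡) (∈-map⁺ bset b∈))

    children-dominated : ∀ {v} bs → All (λ b → BlockBound b v) bs → S v ≡ false → ∀ m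
      → ChildBlocks.Dominated costB m bs
        ⊎ Σ (List (BNode n)) λ ys → ys ⊆ᴸ bs × All (λ b → Active G S v (bset b)) ys × length ys ≡ suc m
    children-dominated {v} bs rs kept m =
      ChildBlocks.dominated-or-active costB (λ b → active? G S v (bset b)) m bs
        (λ b∈ ¬act → bound₁ (All.lookup rs b∈) (inactive⇒deleted G ¬act))
        (λ b∈ _ → bound₃ (All.lookup rs b∈) kept)

    Σ-children-≤ : ∀ (h : Triple → ℕ) bs → All (λ b → h (FB b) ≤ costB b) bs → sum (map h (fBs w s bs)) ≤ costBs bs
    Σ-children-≤ h bs les = begin
      sum (map h (fBs w s bs))     ≡⟨ cong sum (map-fBs h bs) ⟩
      sum (map (λ b → h (FB b)) bs) ≤⟨ sum-map-mono-All bs les ⟩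
      sum (map costB bs)            ≡⟨ sym (costBs≡ bs) ⟩
      costBs bs                     ∎
      where open ℕ.≤-Reasoning

    cut-bound₂ : ∀ {v parent} bs → CutSubtree G (cnode v bs) parent → All (λ b → BlockBound b v) bs → S v ≡ false
      → f₂ (FC (cnode v bs)) ≤ costBs bs
    cut-bound₂ []             _ _              _    = z≤n
    cut-bound₂ (b ∷ [])       _ (r ∷ [])       kept = ℕ.≤-trans (bound₃ r kept) (ℕ.m≤m+n _ 0)
    cut-bound₂ (b ∷ b′ ∷ [])  _ (r ∷ r′ ∷ [])  kept =
      ℕ.+-mono-≤ (bound₃ r kept) (ℕ.≤-trans (bound₃ r′ kept) (ℕ.m≤m+n _ 0))
    cut-bound₂ {v} bs@(b ∷ b′ ∷ b″ ∷ rest) I rs kept with children-dominated bs rs kept 2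
    ... | inj₂ (ys , τ , acts , len) = ⊥-elim (no-three-active-children I kept τ acts len)
    ... | inj₁ dom = begin
      f₂ (FC (cnode v bs))       ≡⟨ cong (λ L → minList (pick2 L)) (map-fBs f₁f₃ bs) ⟩
      minList (pick2 (ChildBlocks.pairs bs))
        ≤⟨ ChildBlocks.minList-pick2-≤ costB b b′ (b″ ∷ rest) (All.map (λ r → bound₃ r kept) rs) dom ⟩
      sum (map costB bs)          ≡⟨ sym (costBs≡ bs) ⟩
      costBs bs                   ∎
      where open ℕ.≤-Reasoning

    cut-bound₃ : ∀ {v parent P} bs → CutSubtree G (cnode v bs) parent → All (λ b → BlockBound b v) bs → S v ≡ false
      → parent ≡ just P → Active G S v P → f₃ (FC (cnode v bs)) ≤ costBs bs
    cut-bound₃ []       _ _        _    _  _ = z≤n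
    cut-bound₃ (b ∷ []) _ (r ∷ []) kept _  _ = ℕ.≤-trans (bound₃ r kept) (ℕ.m≤m+n _ 0)
    cut-bound₃ {v} bs@(b ∷ b′ ∷ rest) I rs@(r ∷ _) kept par actP with children-dominated bs rs kept 1
    ... | inj₂ (ys , τ , acts , len) = ⊥-elim (no-two-active-children-below I kept par actP τ acts len)
    ... | inj₁ dom = begin
      f₃ (FC (cnode v bs))       ≡⟨ cong (λ L → minList (pick1 L)) (map-fBs f₁f₃ bs) ⟩
      minList (pick1 (ChildBlocks.pairs bs)) ≤⟨ ChildBlocks.minList-pick1-≤′ costB b (b′ ∷ rest) (bound₃ r kept) dom ⟩
      sum (map costB bs)          ≡⟨ sym (costBs≡ bs) ⟩
      costBs bs                   ∎
      where open ℕ.≤-Reasoning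

    cut-bound : ∀ {v bs parent} → CutSubtree G (cnode v bs) parent → All (λ b → BlockBound b v) bs
      → CutBound (cnode v bs) parent
    cut-bound {v} {bs} I rs = record
      { bound₁ = λ deleted → ℕ.+-mono-≤ (w≤W w (v-deleted deleted)) (Σ-children-≤ f₂ bs (All.map bound₂ rs))
      ; bound₂ = λ kept → ℕ.≤-trans (cut-bound₂ bs I rs kept) (ℕ.m≤n+m _ _)
      ; bound₃ = λ kept par actP → ℕ.≤-trans (cut-bound₃ bs I rs kept par actP) (ℕ.m≤n+m _ _)
      }
      where
        v-deleted : S v ≡ true → (is v v ∧ S v) ≡ true
        v-deleted deleted rewrite dec-true (v ≟ᶠ v) refl = deleted

    Σ-cuts-≤ : ∀ (h : Triple → ℕ) cs → All (λ c → h (FC c) ≤ costC c) cs → sum (map h (fCs w s cs)) ≤ costCs cs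
    Σ-cuts-≤ h cs les = begin
      sum (map h (fCs w s cs))      ≡⟨ cong sum (map-fCs h cs) ⟩
      sum (map (λ c → h (FC c)) cs) ≤⟨ sum-map-mono-All cs les ⟩
      sum (map costC cs)            ≡⟨ sym (costCs≡ cs) ⟩
      costCs cs                     ∎
      where open ℕ.≤-Reasoning

    W-inner-deleted : ∀ {B} → IsBlock G B → (∀ u → inner B u ≡ true → S u ≡ true)
      → W w (λ u → inner B u ∧ S u) ≡ s B
    W-inner-deleted {B} blk deleted = trans (W-cong w agree) (sym (s≡W-inner blk))
      where
        agree : ∀ u → (inner B u ∧ S u) ≡ inner B u
        agree u with inner B u in e
        ... | true  = deleted u e
        ... | false = refl

    module _ {B cs p} (I : BlockSubtree G (bnode B cs) p) (rs : All (λ c → CutBound c (just B)) cs) where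

      label≢p : ∀ {c} → c ∈ᴸ cs → label c ≢ p
      label≢p c∈ e = parent∉child-cuts G I (subst (_∈ᴸ map label cs) e (∈-map⁺ label c∈))

      child-min-≤ : ∀ {c} → c ∈ᴸ cs → (S (label c) ≡ false → Active G S (label c) B)
        → f₁ (FC c) ⊓ f₃ (FC c) ≤ costC c
      child-min-≤ {c} c∈ active with S (label c) in e
      ... | true  = ℕ.≤-trans (ℕ.m⊓n≤m _ _) (bound₁ (All.lookup rs c∈) e)
      ... | false = ℕ.≤-trans (ℕ.m⊓n≤n _ _) (bound₃ (All.lookup rs c∈) e refl (active refl))

      Σmin-≤ : (∀ {c} → c ∈ᴸ cs → S (label c) ≡ false → Active G S (label c) B)
        → f₃ (FB (bnode B cs)) ≤ costB (bnode B cs)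
      Σmin-≤ active = ℕ.≤-trans (ℕ.≤-reflexive (f₃-block B cs))
        (ℕ.≤-trans (Σ-cuts-≤ _ cs (All.tabulate (λ c∈ → child-min-≤ c∈ (active c∈)))) (ℕ.m≤n+m _ _))

      f₂-≤-Σmin : (∀ {c} → c ∈ᴸ cs → S (label c) ≡ false → Active G S (label c) B)
        → f₂ (FB (bnode B cs)) ≤ costB (bnode B cs)
      f₂-≤-Σmin active = ℕ.≤-trans (f₂≤f₃-block B cs) (Σmin-≤ active)

      block-bound₁ : (∀ {u} → u ∈ B → u ≢ p → S u ≡ true) → f₁ (FB (bnode B cs)) ≤ costB (bnode B cs)
      block-bound₁ deleted = begin
        f₁ (FB (bnode B cs))              ≡⟨ f₁-block B cs ⟩
        s B + sum (map f₁ (fCs w s cs))   ≤⟨ ℕ.+-mono-≤ (ℕ.≤-reflexive (sym (W-inner-deleted blkB inner-deleted)))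
                                                        (Σ-cuts-≤ f₁ cs (All.tabulate child-deleted)) ⟩
        costB (bnode B cs)                ∎
        where
          open ℕ.≤-Reasoning
          blkB : IsBlock G B
          blkB = BlockSubtree.block-sound I (here refl)
          inner-deleted : ∀ u → inner B u ≡ true → S u ≡ true
          inner-deleted u e with inner⇒ e
          ... | u∈ , ¬cp = deleted u∈ λ { refl → ¬cp (proj₁ (BlockSubtree.parent-incident I)) }
          child-deleted : ∀ {c} → c ∈ᴸ cs → f₁ (FC c) ≤ costC c
          child-deleted c∈ = bound₁ (All.lookup rs c∈) (deleted (proj₂ (child-cut G I c∈)) (label≢p c∈))

      block-bound₃ : S p ≡ false → f₃ (FB (bnode B cs)) ≤ costB (bnode B cs)
      block-bound₃ p-kept =
        Σmin-≤ λ c∈ _ → p , proj₂ (BlockSubtree.parent-incident I) , (λ e → label≢p c∈ (sym e)) , p-kept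

    block-bound₂ : ∀ {B p} cs → BlockSubtree G (bnode B cs) p → All (λ c → CutBound c (just B)) cs
      → f₂ (FB (bnode B cs)) ≤ costB (bnode B cs)
    block-bound₂ {B} cs I rs with any? (λ u → (inner B u ≟ᵇ true) ×-dec (S u ≟ᵇ false))
    ... | yes (u , inner-u , u-kept) = f₂-≤-Σmin I rs λ c∈ _ →
      u , proj₁ (inner⇒ inner-u) , (λ { refl → proj₂ (inner⇒ inner-u) (proj₁ (child-cut G I c∈)) }) , u-kept
    block-bound₂     []       _ _  | no _ = z≤n
    block-bound₂ {B} (c ∷ cs) I rs | no none
      with ChildCuts.dominated-or-active costC (λ c → S (label c) ≟ᵇ false) 1 (c ∷ cs)
             (λ c∈ ¬kept → bound₁ (All.lookup rs c∈) (¬-not ¬kept)) (λ c∈ kept → bound₂ (All.lookup rs c∈) kept)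
    ... | inj₂ (y₁ ∷ y₂ ∷ [] , τ , kept₁ ∷ kept₂ ∷ [] , refl) = f₂-≤-Σmin I rs λ {c′} c′∈ _ → other c′
      where
        y₁≢y₂ : label y₁ ≢ label y₂
        y₁≢y₂ = Unique₂⇒≢ (Unique-resp-⊇ (Sublist.map⁺ label τ) (child-cuts-unique G I))
        -- one of the two kept children differs from c′
        other : ∀ c′ → Active G S (label c′) B
        other c′ with label y₁ ≟ᶠ label c′
        ... | yes e = label y₂ , proj₂ (child-cut G I (lookup-⊆ᴸ τ (there (here refl)))) ,
                      (λ e′ → y₁≢y₂ (trans e (sym e′))) , kept₂
        ... | no  n = label y₁ , proj₂ (child-cut G I (lookup-⊆ᴸ τ (here refl))) , n , kept₁
    ... | inj₁ dom with ChildCuts.minList-pick1-≤ costC dom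
    ...   | inj₁ dom₀ = ℕ.≤-trans (f₂≤f₃-block B (c ∷ cs))
                          (ℕ.≤-trans (Σ-cuts-≤ _ (c ∷ cs)
                                        (All.map (ℕ.≤-trans (ℕ.m⊓n≤m _ _)) (ChildCuts.dominated₀ costC dom₀)))
                                     (ℕ.m≤n+m _ (W w (λ u → inner B u ∧ S u))))
    ...   | inj₂ le = begin
      f₂ (FB (bnode B (c ∷ cs)))
        ≤⟨ ℕ.m⊓n≤n _ _ ⟩
      minList (map (s B +_) (pick1 (map f₁f₂ (fCs w s (c ∷ cs)))))
        ≡⟨ cong (λ L → minList (map (s B +_) (pick1 L))) (map-fCs f₁f₂ (c ∷ cs)) ⟩
      minList (map (s B +_) (pick1 (ChildCuts.pairs (c ∷ cs))))
        ≤⟨ minList-map-+ (s B) (pick1 (ChildCuts.pairs (c ∷ cs))) ⟩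
      s B + minList (pick1 (ChildCuts.pairs (c ∷ cs)))
        ≡⟨ cong (_+ _) (sym (W-inner-deleted (BlockSubtree.block-sound I (here refl)) inner-deleted)) ⟩
      W w (λ u → inner B u ∧ S u) + minList (pick1 (ChildCuts.pairs (c ∷ cs)))
        ≤⟨ ℕ.+-monoʳ-≤ (W w (λ u → inner B u ∧ S u)) le ⟩
      W w (λ u → inner B u ∧ S u) + sum (map costC (c ∷ cs))
        ≡⟨ cong (W w (λ u → inner B u ∧ S u) +_) (sym (costCs≡ (c ∷ cs))) ⟩
      costB (bnode B (c ∷ cs)) ∎
      where
        open ℕ.≤-Reasoning
        inner-deleted : ∀ u → inner B u ≡ true → S u ≡ true
        inner-deleted u e = ¬-not (λ kept → none (u , e , kept))

    block-bound : ∀ {B cs p} → BlockSubtree G (bnode B cs) p → All (λ c → CutBound c (just B)) cs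
      → BlockBound (bnode B cs) p
    block-bound {cs = cs} I rs = record
      { bound₁ = block-bound₁ I rs ; bound₂ = block-bound₂ cs I rs ; bound₃ = block-bound₃ I rs }

    mutual
      cutBound : ∀ c {parent} → CutSubtree G c parent → CutBound c parent
      cutBound (cnode v bs) I = cut-bound I (All-blockBounds bs (child-blockSubtree G I))

      All-blockBounds : ∀ bs {v} → (∀ {b} → b ∈ᴸ bs → BlockSubtree G b v) → All (λ b → BlockBound b v) bs
      All-blockBounds []       _   = []
      All-blockBounds (b ∷ bs) sub = blockBound b (sub (here refl)) ∷ All-blockBounds bs (λ b∈ → sub (there b∈))

      blockBound : ∀ b {p} → BlockSubtree G b p → BlockBound b p
      blockBound (bnode B cs) I = block-bound I (All-cutBounds cs (child-cutSubtree G I))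

      All-cutBounds : ∀ cs {B} → (∀ {c} → c ∈ᴸ cs → CutSubtree G c (just B)) → All (λ c → CutBound c (just B)) cs
      All-cutBounds []       _   = []
      All-cutBounds (c ∷ cs) sub = cutBound c (sub (here refl)) ∷ All-cutBounds cs (λ c∈ → sub (there c∈))

    fRoot-≤-cost : ∀ {parent} → CutSubtree G T parent → fRoot w s T ≤ costC T
    fRoot-≤-cost I with S (label T) in e
    ... | true  = ℕ.≤-trans (ℕ.m⊓n≤m _ _) (bound₁ (cutBound T I) e)
    ... | false = ℕ.≤-trans (ℕ.m⊓n≤n _ _) (bound₂ (cutBound T I) e)

    Σcuts : List (Fin n) → ℕ
    Σcuts vs = sum (map (λ v → W w (λ u → is v u ∧ S u)) vs)

    Σblocks : List (Subset n) → ℕ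
    Σblocks Bs = sum (map (λ B → W w (λ u → inner B u ∧ S u)) Bs)

    mutual
      costC-split : ∀ c → costC c ≡ Σcuts (cutsC c) + Σblocks (blocksC c)
      costC-split (cnode v bs) = trans (cong (W w (λ u → is v u ∧ S u) +_) (costBs-split bs))
        (sym (ℕ.+-assoc (W w (λ u → is v u ∧ S u)) (Σcuts (cutsBs bs)) (Σblocks (blocksBs bs))))

      costBs-split : ∀ bs → costBs bs ≡ Σcuts (cutsBs bs) + Σblocks (blocksBs bs)
      costBs-split []       = refl
      costBs-split (b ∷ bs) = begin
        costB b + costBs bs
          ≡⟨ cong₂ _+_ (costB-split b) (costBs-split bs) ⟩
        (Σcuts (cutsB b) + Σblocks (blocksB b)) + (Σcuts (cutsBs bs) + Σblocks (blocksBs bs))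
          ≡⟨ +-interchange (Σcuts (cutsB b)) (Σblocks (blocksB b)) (Σcuts (cutsBs bs)) (Σblocks (blocksBs bs)) ⟩
        (Σcuts (cutsB b) + Σcuts (cutsBs bs)) + (Σblocks (blocksB b) + Σblocks (blocksBs bs))
          ≡⟨ cong₂ _+_ (sym (sum-map-++ _ (cutsB b) _)) (sym (sum-map-++ _ (blocksB b) _)) ⟩
        Σcuts (cutsB b ++ cutsBs bs) + Σblocks (blocksB b ++ blocksBs bs) ∎
        where open ≡-Reasoning

      costB-split : ∀ b → costB b ≡ Σcuts (cutsB b) + Σblocks (blocksB b)
      costB-split (bnode B cs) = trans (cong (W w (λ u → inner B u ∧ S u) +_) (costCs-split cs))
        (+-exchange (W w (λ u → inner B u ∧ S u)) (Σcuts (cutsCs cs)) (Σblocks (blocksCs cs)))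

      costCs-split : ∀ cs → costCs cs ≡ Σcuts (cutsCs cs) + Σblocks (blocksCs cs)
      costCs-split []       = refl
      costCs-split (c ∷ cs) = begin
        costC c + costCs cs
          ≡⟨ cong₂ _+_ (costC-split c) (costCs-split cs) ⟩
        (Σcuts (cutsC c) + Σblocks (blocksC c)) + (Σcuts (cutsCs cs) + Σblocks (blocksCs cs))
          ≡⟨ +-interchange (Σcuts (cutsC c)) (Σblocks (blocksC c)) (Σcuts (cutsCs cs)) (Σblocks (blocksCs cs)) ⟩
        (Σcuts (cutsC c) + Σcuts (cutsCs cs)) + (Σblocks (blocksC c) + Σblocks (blocksCs cs))
          ≡⟨ cong₂ _+_ (sym (sum-map-++ _ (cutsC c) _)) (sym (sum-map-++ _ (blocksC c) _)) ⟩
        Σcuts (cutsC c ++ cutsCs cs) + Σblocks (blocksC c ++ blocksCs cs) ∎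
        where open ≡-Reasoning

    -- every vertex is owned by at most one node of T
    module _ (bg : BlockGraph G) (conn : Connected G) (I : CutSubtree G T nothing) where

      private
        cutCharge : Fin n → Fin n → ℕ
        cutCharge v u = if is v u ∧ S u then w u else 0

        blockCharge : Subset n → Fin n → ℕ
        blockCharge B u = if inner B u ∧ S u then w u else 0

        cutsAt : Fin n → ℕ
        cutsAt u = sum (map (λ v → cutCharge v u) (cutsC T))

        blocksAt : Fin n → ℕ
        blocksAt u = sum (map (λ B → blockCharge B u) (blocksC T))

        if-∧ : ∀ b c {x} → (if b ∧ c then x else 0) ≡ (if b then (if c then x else 0) else 0)
        if-∧ true  _ = refl
        if-∧ false _ = refl

        charged-cuts-≤ : ∀ u → cutsAt u ≤ (if S u then w u else 0)
        charged-cuts-≤ u = ℕ.≤-trans (ℕ.≤-reflexive (sum-map-cong (cutsC T) (λ v → if-∧ (is v u) (S u))))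
          (sum-at-most-one (λ v → is v u) _ (cutsC T) (CutSubtree.cuts-unique I)
            λ _ _ v≢v′ e e′ → v≢v′ (trans (sym (does⇒ (u ≟ᶠ _) e)) (does⇒ (u ≟ᶠ _) e′)))

        charged-blocks-≤ : ∀ u → blocksAt u ≤ (if S u then w u else 0)
        charged-blocks-≤ u = ℕ.≤-trans (ℕ.≤-reflexive (sum-map-cong (blocksC T) (λ B → if-∧ (inner B u) (S u))))
          (sum-at-most-one (λ B → inner B u) _ (blocksC T) (CutSubtree.blocks-unique I)
            λ B∈ B′∈ B≢B′ e e′ → proj₂ (inner⇒ e)
              (shared-vertex-cutpoint G bg conn (CutSubtree.block-sound I B∈) (CutSubtree.block-sound I B′∈) B≢B′
                (proj₁ (inner⇒ e)) (proj₁ (inner⇒ e′))))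

        uncharged-cuts : ∀ {u} → ¬ Cutpoint G u → cutsAt u ≡ 0
        uncharged-cuts {u} ¬cp = sum-map-zero _ (cutsC T) λ {v} v∈ → trans (if-∧ (is v u) (S u)) (not-v v∈)
          where
            not-v : ∀ {v} → v ∈ᴸ cutsC T → (if is v u then (if S u then w u else 0) else 0) ≡ 0
            not-v {v} v∈ with u ≟ᶠ v
            ... | yes refl = ⊥-elim (¬cp (Equivalence.to (cutpoints-of-T u) v∈))
            ... | no  _    = refl

        uncharged-blocks : ∀ {u} → Cutpoint G u → blocksAt u ≡ 0
        uncharged-blocks {u} cp = sum-map-zero _ (blocksC T) λ {B} _ → trans (if-∧ (inner B u) (S u)) (not-inner B)
          where
            not-inner : ∀ B → (if inner B u then (if S u then w u else 0) else 0) ≡ 0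
            not-inner B with inner B u in e
            ... | true  = ⊥-elim (proj₂ (inner⇒ e) cp)
            ... | false = refl

        charge-≤ : ∀ u → cutsAt u + blocksAt u
                         ≤ (if S u then w u else 0)
        charge-≤ u with cutpoint? u
        ... | yes cp = begin
          cutsAt u + blocksAt u ≡⟨ cong (cutsAt u +_) (uncharged-blocks cp) ⟩
          cutsAt u + 0          ≡⟨ ℕ.+-identityʳ (cutsAt u) ⟩
          cutsAt u              ≤⟨ charged-cuts-≤ u ⟩
          _                     ∎
          where open ℕ.≤-Reasoning
        ... | no ¬cp = begin
          cutsAt u + blocksAt u ≡⟨ cong (_+ blocksAt u) (uncharged-cuts ¬cp) ⟩
          blocksAt u            ≤⟨ charged-blocks-≤ u ⟩
          _                     ∎
          where open ℕ.≤-Reasoning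

      cost-≤-weight : costC T ≤ W w S
      cost-≤-weight = begin
        costC T
          ≡⟨ costC-split T ⟩
        Σcuts (cutsC T) + Σblocks (blocksC T)
          ≡⟨ cong₂ _+_ (sum-map-swap cutCharge (cutsC T) (allFin n)) (sum-map-swap blockCharge (blocksC T) (allFin n)) ⟩
        sum (map cutsAt (allFin n)) + sum (map blocksAt (allFin n))
          ≡⟨ sym (sum-map-+ _ _ (allFin n)) ⟩
        sum (map (λ u → cutsAt u + blocksAt u) (allFin n))
          ≤⟨ sum-map-mono (allFin n) charge-≤ ⟩
        W w S ∎
        where open ℕ.≤-Reasoning

  module UpperBound where

    ParentDeleted : CNode n → Maybe (Subset n) → Deletion → Set
    ParentDeleted c parent S = ∀ {P} → parent ≡ just P → ∀ {x} → x ∈ P → x ≢ label c → S x ≡ true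

    -- Claw-freeness is required of every extension S of the witness, as the
    -- final set also deletes outside the subtree.
    record CutWitness (c : CNode n) (parent : Maybe (Subset n)) (i : Regime) : Set where
      field
        set       : Deletion
        weight-≤  : W w set ≤ f⟨ i ⟩ (FC c)
        deletes   : i ≡ ₁ → set (label c) ≡ true
        claw-free : ∀ S → set ⊆ᵈ S → (i ≡ ₂ → ParentDeleted c parent S)
                    → ∀ {a} → a ∈ᴸ cutsC c → LocallyClawFree G S a

    record BlockWitness (b : BNode n) (p : Fin n) (i : Regime) : Set where
      field
        set       : Deletion
        weight-≤  : W w set ≤ f⟨ i ⟩ (FB b)
        deletes   : i ≡ ₁ → ∀ {x} → x ∈ bset b → x ≢ p → set x ≡ true
        claw-free : ∀ S → set ⊆ᵈ S → (i ≡ ₂ → S p ≡ true)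
                    → ∀ {a} → a ∈ᴸ cutsB b → LocallyClawFree G S a

    CutWitnesses : CNode n → Maybe (Subset n) → Set
    CutWitnesses c parent = ∀ i → CutWitness c parent i

    BlockWitnesses : BNode n → Fin n → Set
    BlockWitnesses b p = ∀ i → BlockWitness b p i

    deleted-block-inactive : ∀ {b v S} (wb : BlockWitness b v ₁) → BlockWitness.set wb ⊆ᵈ S → ¬ Active G S v (bset b)
    deleted-block-inactive wb sub (x , x∈ , x≢v , kept) =
      true≢false (trans (sym (sub (BlockWitness.deletes wb refl x∈ x≢v))) kept)

    ⋃B : ∀ {v} (r : BNode n → Regime) {bs} → All (λ b → BlockWitnesses b v) bs → Deletion
    ⋃B r = ⋃ (λ {b} ws → BlockWitness.set (ws (r b)))

    ⋃C : ∀ {B} (r : CNode n → Regime) {cs} → All (λ c → CutWitnesses c (just B)) cs → Deletion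
    ⋃C r = ⋃ (λ {c} ws → CutWitness.set (ws (r c)))

    W-⋃B : ∀ {v} r {bs} (ws : All (λ b → BlockWitnesses b v) bs)
      → W w (⋃B r ws) ≤ sum (map (λ b → f⟨ r b ⟩ (FB b)) bs)
    W-⋃B r = W-⋃ _ w _ (λ {b} ws → BlockWitness.weight-≤ (ws (r b)))

    W-⋃C : ∀ {B} r {cs} (ws : All (λ c → CutWitnesses c (just B)) cs)
      → W w (⋃C r ws) ≤ sum (map (λ c → f⟨ r c ⟩ (FC c)) cs)
    W-⋃C r = W-⋃ _ w _ (λ {c} ws → CutWitness.weight-≤ (ws (r c)))

    ⋃B-claw-free : ∀ {v} r {bs} (ws : All (λ b → BlockWitnesses b v) bs) S → ⋃B r ws ⊆ᵈ S
      → (∀ {b} → b ∈ᴸ bs → r b ≡ ₂ → S v ≡ true) → ∀ {a} → a ∈ᴸ cutsBs bs → LocallyClawFree G S a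
    ⋃B-claw-free r {bs} ws S sub ₂⇒deleted a∈ with ∈-cutsBs⁻ bs a∈
    ... | b , b∈ , a∈b = BlockWitness.claw-free (All.lookup ws b∈ (r b)) S
                           (λ e → sub (⊆-⋃ (λ {b} ws → BlockWitness.set (ws (r b))) ws b∈ e)) (₂⇒deleted b∈) a∈b

    ⋃B-deleted-inactive : ∀ {v} {bs} (ws : All (λ b → BlockWitnesses b v) bs) {S} → ⋃B (λ _ → ₁) ws ⊆ᵈ S
      → ∀ {b} → b ∈ᴸ bs → ¬ Active G S v (bset b)
    ⋃B-deleted-inactive ws sub b∈ =
      deleted-block-inactive (All.lookup ws b∈ ₁) (λ e → sub (⊆-⋃ (λ {b} ws → BlockWitness.set (ws ₁)) ws b∈ e))

    ⋃C-claw-free : ∀ {B} r {cs} (ws : All (λ c → CutWitnesses c (just B)) cs) S → ⋃C r ws ⊆ᵈ S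
      → (∀ {c} → c ∈ᴸ cs → r c ≡ ₂ → ParentDeleted c (just B) S)
      → ∀ {a} → a ∈ᴸ cutsCs cs → LocallyClawFree G S a
    ⋃C-claw-free r {cs} ws S sub ₂⇒deleted a∈ with ∈-cutsCs⁻ cs a∈
    ... | c , c∈ , a∈c = CutWitness.claw-free (All.lookup ws c∈ (r c)) S
                           (λ e → sub (⊆-⋃ (λ {c} ws → CutWitness.set (ws (r c))) ws c∈ e)) (₂⇒deleted c∈) a∈c

    private
      just-≡ : ∀ {parent : Maybe (Subset n)} {B B′} → parent ≡ just B → parent ≡ just B′ → B ≡ B′
      just-≡ refl refl = refl

      ≡-≡ : ∀ {B₀ B B′ : Subset n} → B ≡ B₀ → B′ ≡ B₀ → B ≡ B′
      ≡-≡ refl refl = refl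

    cut-witness₁ : ∀ {v bs parent} → All (λ b → BlockWitnesses b v) bs → CutWitness (cnode v bs) parent ₁
    cut-witness₁ {v} {bs} {parent} ws = record
      { set       = D
      ; weight-≤  = weight-D
      ; deletes   = λ _ → v∈D
      ; claw-free = claw-free
      }
      where
        D : Deletion
        D = is v ∪ᵈ ⋃B (λ _ → ₂) ws
        v∈D : D v ≡ true
        v∈D = ⊆-∪ˡ (is v) (⋃B (λ _ → ₂) ws) (dec-true (v ≟ᶠ v) refl)
        weight-D : W w D ≤ w v + sum (map f₂ (fBs w s bs))
        weight-D = ℕ.≤-trans (W-∪ w (is v) _)
          (ℕ.+-mono-≤ (W-singleton w (λ u e → does⇒ (u ≟ᶠ v) e))
                      (ℕ.≤-trans (W-⋃B (λ _ → ₂) ws) (ℕ.≤-reflexive (sym (cong sum (map-fBs f₂ bs))))))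
        claw-free : ∀ S → D ⊆ᵈ S → (₁ ≡ ₂ → ParentDeleted (cnode v bs) parent S)
          → ∀ {a} → a ∈ᴸ cutsC (cnode v bs) → LocallyClawFree G S a
        claw-free S sub _ (here refl) kept = ⊥-elim (true≢false (trans (sym (sub v∈D)) kept))
        claw-free S sub _ (there a∈)       =
          ⋃B-claw-free (λ _ → ₂) ws S (∪-⊆ʳ (is v) (⋃B (λ _ → ₂) ws) sub) (λ _ _ → sub v∈D) a∈

    cut-witness-leaf : ∀ {v parent i} → CutSubtree G (cnode v []) parent → i ≢ ₁ → CutWitness (cnode v []) parent i
    cut-witness-leaf {v} {parent} {i} I i≢₁ = record
      { set       = λ _ → false
      ; weight-≤  = ℕ.≤-trans (ℕ.≤-reflexive (W-∅ w)) z≤n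
      ; deletes   = λ i≡₁ → ⊥-elim (i≢₁ i≡₁)
      ; claw-free = claw-free
      }
      where
        claw-free : ∀ S → (λ _ → false) ⊆ᵈ S → (i ≡ ₂ → ParentDeleted (cnode v []) parent S)
          → ∀ {a} → a ∈ᴸ cutsC (cnode v []) → LocallyClawFree G S a
        claw-free S _ _ (here refl) = two-candidates⇒locallyClawFree G just-≡ just-≡ candidate
          where
            candidate : ∀ {B} → IsBlock G B → v ∈ B → Active G S v B → parent ≡ just B ⊎ parent ≡ just B
            candidate blk v∈ _ with blocks-at-cutpoint G I blk v∈
            ... | inj₁ e = inj₁ e
            ... | inj₂ ()

    cut-witness-one : ∀ {v bs parent i} xs₁ x xs₂ → bs ≡ xs₁ ++ x ∷ xs₂
      → CutSubtree G (cnode v bs) parent → All (λ b → BlockWitnesses b v) bs → i ≢ ₁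
      → f₃ (FB x) + sum (map (λ b → f₁ (FB b)) (xs₁ ++ xs₂)) ≤ f⟨ i ⟩ (FC (cnode v bs))
      → CutWitness (cnode v bs) parent i
    cut-witness-one {v} {parent = parent} {i} xs₁ x xs₂ refl I ws i≢₁ bound with All-++-∷⁻ xs₁ ws
    ... | wx , rest = record
      { set       = D
      ; weight-≤  = ℕ.≤-trans (W-∪ w Dx Drest)
                      (ℕ.≤-trans (ℕ.+-mono-≤ (BlockWitness.weight-≤ (wx ₃)) (W-⋃B (λ _ → ₁) rest)) bound)
      ; deletes   = λ i≡₁ → ⊥-elim (i≢₁ i≡₁)
      ; claw-free = claw-free
      }
      where
        Dx : Deletion
        Dx = BlockWitness.set (wx ₃)
        Drest : Deletion
        Drest = ⋃B (λ _ → ₁) rest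
        D : Deletion
        D = Dx ∪ᵈ Drest
        claw-free : ∀ S → D ⊆ᵈ S → (i ≡ ₂ → ParentDeleted (cnode v (xs₁ ++ x ∷ xs₂)) parent S)
          → ∀ {a} → a ∈ᴸ cutsC (cnode v (xs₁ ++ x ∷ xs₂)) → LocallyClawFree G S a
        claw-free S sub _ (here refl) = two-candidates⇒locallyClawFree G just-≡ ≡-≡ candidate
          where
            candidate : ∀ {B} → IsBlock G B → v ∈ B → Active G S v B → parent ≡ just B ⊎ B ≡ bset x
            candidate blk v∈ act with blocks-at-cutpoint G I blk v∈
            ... | inj₁ e  = inj₁ e
            ... | inj₂ B∈ with ∈-map⁻ bset B∈
            ...   | b , b∈ , refl with ∈-++-∷⁻ xs₁ b∈
            ...     | inj₁ refl = inj₂ refl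
            ...     | inj₂ b∈′  = ⊥-elim (⋃B-deleted-inactive rest (∪-⊆ʳ Dx Drest sub) b∈′ act)
        claw-free S sub _ (there a∈) with ∈-cutsBs⁻ (xs₁ ++ x ∷ xs₂) a∈
        ... | b , b∈ , a∈b with ∈-++-∷⁻ xs₁ b∈
        ...   | inj₁ refl = BlockWitness.claw-free (wx ₃) S (∪-⊆ˡ Dx Drest sub) (λ ()) a∈b
        ...   | inj₂ b∈′  = ⋃B-claw-free (λ _ → ₁) rest S (∪-⊆ʳ Dx Drest sub) (λ _ ()) (∈-cutsBs b∈′ a∈b)

    cut-witness-two : ∀ {v bs parent} xs₁ x xs₂ y xs₃ → bs ≡ xs₁ ++ x ∷ xs₂ ++ y ∷ xs₃
      → CutSubtree G (cnode v bs) parent → All (λ b → BlockWitnesses b v) bs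
      → f₃ (FB x) + (f₃ (FB y) + sum (map (λ b → f₁ (FB b)) (xs₁ ++ xs₂ ++ xs₃))) ≤ f₂ (FC (cnode v bs))
      → CutWitness (cnode v bs) parent ₂
    cut-witness-two {v} {parent = parent} xs₁ x xs₂ y xs₃ refl I ws bound with All-++-∷-++-∷⁻ xs₁ ws
    ... | wx , wy , rest = record
      { set       = D
      ; weight-≤  = ℕ.≤-trans (W-∪ w Dx _) (ℕ.≤-trans (ℕ.+-mono-≤ (BlockWitness.weight-≤ (wx ₃))
                      (ℕ.≤-trans (W-∪ w Dy Drest)
                        (ℕ.+-mono-≤ (BlockWitness.weight-≤ (wy ₃)) (W-⋃B (λ _ → ₁) rest)))) bound)
      ; deletes   = λ ()
      ; claw-free = claw-free
      }
      where
        Dx : Deletion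
        Dx = BlockWitness.set (wx ₃)
        Dy : Deletion
        Dy = BlockWitness.set (wy ₃)
        Drest : Deletion
        Drest = ⋃B (λ _ → ₁) rest
        D : Deletion
        D = Dx ∪ᵈ (Dy ∪ᵈ Drest)
        bs : List (BNode n)
        bs = xs₁ ++ x ∷ xs₂ ++ y ∷ xs₃
        claw-free : ∀ S → D ⊆ᵈ S → (₂ ≡ ₂ → ParentDeleted (cnode v bs) parent S)
          → ∀ {a} → a ∈ᴸ cutsC (cnode v bs) → LocallyClawFree G S a
        claw-free S sub parent-deleted (here refl) = two-candidates⇒locallyClawFree G ≡-≡ ≡-≡ candidate
          where
            candidate : ∀ {B} → IsBlock G B → v ∈ B → Active G S v B → B ≡ bset x ⊎ B ≡ bset y
            candidate blk v∈ act@(z , z∈ , z≢v , kept) with blocks-at-cutpoint G I blk v∈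
            ... | inj₁ e  = ⊥-elim (true≢false (trans (sym (parent-deleted refl e z∈ z≢v)) kept))
            ... | inj₂ B∈ with ∈-map⁻ bset B∈
            ...   | b , b∈ , refl with ∈-++-∷-++-∷⁻ xs₁ b∈
            ...     | inj₁ refl        = inj₁ refl
            ...     | inj₂ (inj₁ refl) = inj₂ refl
            ...     | inj₂ (inj₂ b∈′)  =
              ⊥-elim (⋃B-deleted-inactive rest (∪-⊆ʳ Dy Drest (∪-⊆ʳ Dx (Dy ∪ᵈ Drest) sub)) b∈′ act)
        claw-free S sub _ (there a∈) with ∈-cutsBs⁻ bs a∈
        ... | b , b∈ , a∈b with ∈-++-∷-++-∷⁻ xs₁ b∈
        ...   | inj₁ refl        = BlockWitness.claw-free (wx ₃) S (∪-⊆ˡ Dx (Dy ∪ᵈ Drest) sub) (λ ()) a∈b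
        ...   | inj₂ (inj₁ refl) = BlockWitness.claw-free (wy ₃) S
                                     (∪-⊆ˡ Dy Drest (∪-⊆ʳ Dx (Dy ∪ᵈ Drest) sub)) (λ ()) a∈b
        ...   | inj₂ (inj₂ b∈′)  = ⋃B-claw-free (λ _ → ₁) rest S
                                     (∪-⊆ʳ Dy Drest (∪-⊆ʳ Dx (Dy ∪ᵈ Drest) sub)) (λ _ ()) (∈-cutsBs b∈′ a∈b)

    cut-witness : ∀ {v bs parent} → CutSubtree G (cnode v bs) parent → All (λ b → BlockWitnesses b v) bs
      → CutWitnesses (cnode v bs) parent
    cut-witness                          I ws ₁ = cut-witness₁ ws
    cut-witness {bs = []}                I ws ₂ = cut-witness-leaf I (λ ())
    cut-witness {bs = []}                I ws ₃ = cut-witness-leaf I (λ ())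
    cut-witness {bs = b ∷ []}            I ws ₂ = cut-witness-one [] b [] refl I ws (λ ()) (ℕ.≤-reflexive (ℕ.+-identityʳ _))
    cut-witness {bs = b ∷ []}            I ws ₃ = cut-witness-one [] b [] refl I ws (λ ()) (ℕ.≤-reflexive (ℕ.+-identityʳ _))
    cut-witness {bs = b ∷ b′ ∷ []}       I ws ₂ =
      cut-witness-two [] b [] b′ [] refl I ws (ℕ.≤-reflexive (cong (f₃ (FB b) +_) (ℕ.+-identityʳ _)))
    cut-witness {bs = bs@(b ∷ b′ ∷ b″ ∷ rest)} I ws ₂ with ChildBlocks.minList-pick2-split b b′ (b″ ∷ rest)
    ... | xs₁ , x , xs₂ , y , xs₃ , split , min≡ =
      cut-witness-two xs₁ x xs₂ y xs₃ split I ws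
        (ℕ.≤-reflexive (trans (sym min≡) (cong (λ L → minList (pick2 L)) (sym (map-fBs f₁f₃ bs)))))
    cut-witness {bs = bs@(b ∷ b′ ∷ rest)} I ws ₃ with ChildBlocks.minList-pick1-split b (b′ ∷ rest)
    ... | xs₁ , x , xs₂ , split , min≡ =
      cut-witness-one xs₁ x xs₂ split I ws (λ ())
        (ℕ.≤-reflexive (trans (sym min≡) (cong (λ L → minList (pick1 L)) (sym (map-fBs f₁f₃ bs)))))

    module _ {B cs p} (I : BlockSubtree G (bnode B cs) p) (ws : All (λ c → CutWitnesses c (just B)) cs) where

      private
        blkB : IsBlock G B
        blkB = BlockSubtree.block-sound I (here refl)

        label∈⋃C : ∀ {c} → c ∈ᴸ cs → ⋃C (λ _ → ₁) ws (label c) ≡ true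
        label∈⋃C c∈ = ⊆-⋃ (λ {c} ws → CutWitness.set (ws ₁)) ws c∈ (CutWitness.deletes (All.lookup ws c∈ ₁) refl)

      block-witness₁ : BlockWitness (bnode B cs) p ₁
      block-witness₁ = record
        { set       = D
        ; weight-≤  = ℕ.≤-trans (W-∪ w (inner B) _) (ℕ.≤-trans
                        (ℕ.+-mono-≤ (ℕ.≤-reflexive (sym (s≡W-inner blkB)))
                                    (ℕ.≤-trans (W-⋃C (λ _ → ₁) ws) (ℕ.≤-reflexive (sym (cong sum (map-fCs f₁ cs))))))
                        (ℕ.≤-reflexive (sym (f₁-block B cs))))
        ; deletes   = λ _ → deletes
        ; claw-free = λ S sub _ a∈ →
            ⋃C-claw-free (λ _ → ₁) ws S (∪-⊆ʳ (inner B) (⋃C (λ _ → ₁) ws) sub) (λ _ ()) a∈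
        }
        where
          D : Deletion
          D = inner B ∪ᵈ ⋃C (λ _ → ₁) ws
          deletes : ∀ {x} → x ∈ B → x ≢ p → D x ≡ true
          deletes {x} x∈ x≢p with cutpoint? x
          ... | no ¬cp = ⊆-∪ˡ (inner B) (⋃C (λ _ → ₁) ws) (inner⇐ x∈ ¬cp)
          ... | yes cp with cutpoints-in-block G I cp x∈
          ...   | inj₁ x≡p = ⊥-elim (x≢p x≡p)
          ...   | inj₂ x∈cs with ∈-map⁻ label x∈cs
          ...     | c , c∈ , refl = ⊆-∪ʳ (inner B) (⋃C (λ _ → ₁) ws) (label∈⋃C c∈)

      private
        cheaper : CNode n → Regime
        cheaper c with ℕ.≤-total (f₁ (FC c)) (f₃ (FC c))
        ... | inj₁ _ = ₁
        ... | inj₂ _ = ₃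

        f⟨cheaper⟩ : ∀ c → f⟨ cheaper c ⟩ (FC c) ≡ f₁ (FC c) ⊓ f₃ (FC c)
        f⟨cheaper⟩ c with ℕ.≤-total (f₁ (FC c)) (f₃ (FC c))
        ... | inj₁ le = sym (ℕ.m≤n⇒m⊓n≡m le)
        ... | inj₂ ge = sym (ℕ.m≥n⇒m⊓n≡n ge)

        cheaper≢₂ : ∀ c → cheaper c ≢ ₂
        cheaper≢₂ c with ℕ.≤-total (f₁ (FC c)) (f₃ (FC c))
        ... | inj₁ _ = λ ()
        ... | inj₂ _ = λ ()

      block-witness-cheaper : ∀ {i} → i ≢ ₁ → f₃ (FB (bnode B cs)) ≤ f⟨ i ⟩ (FB (bnode B cs))
        → BlockWitness (bnode B cs) p i
      block-witness-cheaper i≢₁ bound = record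
        { set       = ⋃C cheaper ws
        ; weight-≤  = ℕ.≤-trans (W-⋃C cheaper ws) (ℕ.≤-trans (ℕ.≤-reflexive (trans (sum-map-cong cs f⟨cheaper⟩)
                        (trans (sym (cong sum (map-fCs (λ t → f₁ t ⊓ f₃ t) cs))) (sym (f₃-block B cs))))) bound)
        ; deletes   = λ i≡₁ → ⊥-elim (i≢₁ i≡₁)
        ; claw-free = λ S sub _ a∈ →
            ⋃C-claw-free cheaper ws S sub (λ {c} _ e → ⊥-elim (cheaper≢₂ c e)) a∈
        }

    -- deleting all of B but label x is what regime ₂ at x requires
    block-witness-one : ∀ {B cs p} xs₁ x xs₂ → cs ≡ xs₁ ++ x ∷ xs₂
      → BlockSubtree G (bnode B cs) p → All (λ c → CutWitnesses c (just B)) cs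
      → s B + (f₂ (FC x) + sum (map (λ c → f₁ (FC c)) (xs₁ ++ xs₂))) ≤ f₂ (FB (bnode B cs))
      → BlockWitness (bnode B cs) p ₂
    block-witness-one {B} {p = p} xs₁ x xs₂ refl I ws bound with All-++-∷⁻ xs₁ ws
    ... | wx , rest = record
      { set       = D
      ; weight-≤  = ℕ.≤-trans (W-∪ w (inner B) _) (ℕ.≤-trans (ℕ.+-mono-≤
                      (ℕ.≤-reflexive (sym (s≡W-inner (BlockSubtree.block-sound I (here refl)))))
                      (ℕ.≤-trans (W-∪ w Dx Drest)
                        (ℕ.+-mono-≤ (CutWitness.weight-≤ (wx ₂)) (W-⋃C (λ _ → ₁) rest)))) bound)
      ; deletes   = λ ()
      ; claw-free = claw-free
      }
      where
        cs : List (CNode n)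
        cs = xs₁ ++ x ∷ xs₂
        Dx : Deletion
        Dx = CutWitness.set (wx ₂)
        Drest : Deletion
        Drest = ⋃C (λ _ → ₁) rest
        D : Deletion
        D = inner B ∪ᵈ (Dx ∪ᵈ Drest)
        claw-free : ∀ S → D ⊆ᵈ S → (₂ ≡ ₂ → S p ≡ true)
          → ∀ {a} → a ∈ᴸ cutsB (bnode B cs) → LocallyClawFree G S a
        claw-free S sub p-deleted a∈ with ∈-cutsCs⁻ cs a∈
        ... | c , c∈ , a∈c with ∈-++-∷⁻ xs₁ c∈
        ...   | inj₂ c∈′  = ⋃C-claw-free (λ _ → ₁) rest S (∪-⊆ʳ Dx Drest {S} (∪-⊆ʳ (inner B) (Dx ∪ᵈ Drest) {S} sub))
                              (λ _ ()) (∈-cutsCs c∈′ a∈c)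
        ...   | inj₁ refl = CutWitness.claw-free (wx ₂) S (∪-⊆ˡ Dx Drest {S} (∪-⊆ʳ (inner B) (Dx ∪ᵈ Drest) {S} sub))
                              (λ _ → B-deleted) a∈c
          where
            B-deleted : ParentDeleted x (just B) S
            B-deleted refl {y} y∈ y≢x with cutpoint? y
            ... | no ¬cp = sub (⊆-∪ˡ (inner B) (Dx ∪ᵈ Drest) (inner⇐ y∈ ¬cp))
            ... | yes cp with cutpoints-in-block G I cp y∈
            ...   | inj₁ refl = p-deleted refl
            ...   | inj₂ y∈cs with ∈-map⁻ label y∈cs
            ...     | c′ , c′∈ , refl with ∈-++-∷⁻ xs₁ c′∈
            ...       | inj₁ refl  = ⊥-elim (y≢x refl)
            ...       | inj₂ c′∈′ = sub (⊆-∪ʳ (inner B) (Dx ∪ᵈ Drest) (⊆-∪ʳ Dx Drest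
                                        (⊆-⋃ (λ {c} ws → CutWitness.set (ws ₁)) rest c′∈′
                                          (CutWitness.deletes (All.lookup rest c′∈′ ₁) refl))))

    block-witness : ∀ {B cs p} → BlockSubtree G (bnode B cs) p → All (λ c → CutWitnesses c (just B)) cs
      → BlockWitnesses (bnode B cs) p
    block-witness I ws ₁ = block-witness₁ I ws
    block-witness I ws ₃ = block-witness-cheaper I ws (λ ()) ℕ.≤-refl
    block-witness {cs = []} I ws ₂ = block-witness-cheaper I ws (λ ()) ℕ.≤-refl
    block-witness {B} {cs = cs@(_ ∷ _)} I ws ₂
      with ℕ.≤-total (f₃ (FB (bnode B cs))) (minList (map (s B +_) (pick1 (map f₁f₂ (fCs w s cs)))))
    ... | inj₁ le = block-witness-cheaper I ws (λ ()) (ℕ.≤-reflexive (sym (ℕ.m≤n⇒m⊓n≡m le)))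
    ... | inj₂ ge with minList-map-+-attained (s B) (pick1 (ChildCuts.pairs cs))
    ...   | inj₁ ()
    ...   | inj₂ (e , e∈ , min≡) with ChildCuts.pick1-split cs e∈
    ...     | xs₁ , x , xs₂ , split , e≡ = block-witness-one xs₁ x xs₂ split I ws (ℕ.≤-reflexive (begin
      s B + (f₂ (FC x) + _)
        ≡⟨ cong (s B +_) (sym e≡) ⟩
      s B + e
        ≡⟨ sym min≡ ⟩
      minList (map (s B +_) (pick1 (ChildCuts.pairs cs)))
        ≡⟨ cong (λ L → minList (map (s B +_) (pick1 L))) (sym (map-fCs f₁f₂ cs)) ⟩
      minList (map (s B +_) (pick1 (map f₁f₂ (fCs w s cs))))
        ≡⟨ sym (ℕ.m≥n⇒m⊓n≡n ge) ⟩
      f₂ (FB (bnode B cs)) ∎))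
      where open ≡-Reasoning

    mutual
      cutWitnesses : ∀ c {parent} → CutSubtree G c parent → CutWitnesses c parent
      cutWitnesses (cnode v bs) I = cut-witness I (All-blockWitnesses bs (child-blockSubtree G I))

      All-blockWitnesses : ∀ bs {v} → (∀ {b} → b ∈ᴸ bs → BlockSubtree G b v) → All (λ b → BlockWitnesses b v) bs
      All-blockWitnesses []       _   = []
      All-blockWitnesses (b ∷ bs) sub = blockWitnesses b (sub (here refl)) ∷ All-blockWitnesses bs (λ b∈ → sub (there b∈))

      blockWitnesses : ∀ b {p} → BlockSubtree G b p → BlockWitnesses b p
      blockWitnesses (bnode B cs) I = block-witness I (All-cutWitnesses cs (child-cutSubtree G I))

      All-cutWitnesses : ∀ cs {B} → (∀ {c} → c ∈ᴸ cs → CutSubtree G c (just B)) → All (λ c → CutWitnesses c (just B)) cs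
      All-cutWitnesses []       _   = []
      All-cutWitnesses (c ∷ cs) sub = cutWitnesses c (sub (here refl)) ∷ All-cutWitnesses cs (λ c∈ → sub (there c∈))

    root-witness : CutSubtree G T nothing
      → Σ Deletion λ D → W w D ≤ fRoot w s T × (∀ {a} → a ∈ᴸ cutsC T → LocallyClawFree G D a)
    root-witness I with ℕ.≤-total (f₁ (FC T)) (f₂ (FC T))
    ... | inj₁ le = CutWitness.set wit , ℕ.≤-trans (CutWitness.weight-≤ wit) (ℕ.≤-reflexive (sym (ℕ.m≤n⇒m⊓n≡m le))) ,
                   CutWitness.claw-free wit _ (λ e → e) (λ ())
      where
        wit : CutWitness T nothing ₁
        wit = cutWitnesses T I ₁
    ... | inj₂ ge = CutWitness.set wit , ℕ.≤-trans (CutWitness.weight-≤ wit) (ℕ.≤-reflexive (sym (ℕ.m≥n⇒m⊓n≡n ge))) ,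
                  CutWitness.claw-free wit _ (λ e → e) (λ _ ())
      where
        wit : CutWitness T nothing ₂
        wit = cutWitnesses T I ₂

  module _ (bg : BlockGraph G) (conn : Connected G) (I : CutSubtree G T nothing) where

    fRoot-≤-claw-deletion : ∀ S → ClawDeletionSet G S → fRoot w s T ≤ weight w S
    fRoot-≤-claw-deletion S cds = ℕ.≤-trans (fRoot-≤-cost I) (cost-≤-weight bg conn I)
      where open LowerBound (lookup S) (claw-deletion⇒locallyClawFree G bg cds)

    fRoot-attained : Σ (Subset n) λ S → ClawDeletionSet G S × weight w S ≤ fRoot w s T
    fRoot-attained with UpperBound.root-witness I
    ... | D , D≤ , D-claw-free =
      tabulate D ,
      locallyClawFree⇒claw-deletion G bg conn (λ a cp → D-claw-free (Equivalence.from (cutpoints-of-T a) cp)) ,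
      ℕ.≤-trans (ℕ.≤-reflexive (W-cong w (lookup∘tabulate D))) D≤

    fRoot-minimum : IsMinClawDeletionWeight G w (fRoot w s T)
    fRoot-minimum with fRoot-attained
    ... | S , claw-deletion , S≤ =
      (S , claw-deletion , ℕ.≤-antisym S≤ (fRoot-≤-claw-deletion S claw-deletion)) , fRoot-≤-claw-deletion

theorem4 : ∀ {n} (G : Graph n) (w : Fin n → ℕ) → (∀ u → 1 ≤ w u)
    → Connected G → BlockGraph G → ¬ Complete G
    → (r : Fin n) → Cutpoint G r
    → (T : CNode n) → IsBlockCutpointTree G r T
    → (s : Subset n → ℕ) → IsSFun G w s
    → IsMinClawDeletionWeight G w (fRoot w s T)
theorem4 G w _ conn bg _ _ _ T tree s s-spec =
  Programme.fRoot-minimum G w s T (proj₁ (proj₂ (proj₂ tree))) s-spec bg conn (root-subtree G tree)
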